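{- Let $\mathcal{M}$ be a simple oriented matroid of rank $2$ on a finite set $E$, with set of topes $\mathcal{T}$. (i) The set $$\mathcal{K}^{\ast}:=\bigl\{K\in\mathcal{T}:\ \text{for every } T\in\mathcal{T} \text{ and } e\in E,\ \mathbf{S}(K,T)=\{e\}\Rightarrow K(e)=+\bigr\}$$ is a critical tope committee for $\mathcal{M}$. (ii) This committee equals $\mathrm{max}^+(\mathcal{T})$, the set of topes whose positive parts are inclusion-maximal among $\{T^+: T\in\mathcal{T}\}$.
   Context: An oriented matroid on $E$ is given by its covector set $\mathcal{L}\subseteq\{ -,0,+\}^E$; topes are covectors of inclusion-maximal support. For sign vectors $X,Y$: $X^+:=\{e:X(e)=+\}$ and the separation set is $\mathbf{S}(X,Y):=\{e: X(e)=-Y(e)\neq 0\}$. Simple: no loops (elements $e$ with $T(e)=0$ for all topes), no parallel elements ($X(e)=X(f)$ for all covectors), no antiparallel elements ($X(e)=-X(f)$ for all covectors). For a set $\mathcal{P}$ of sign vectors, $\mathrm{max}^+(\mathcal{P}):=\{P\in\mathcal{P}: P^+ \text{ is inclusion-maximal in } \{R^+:R\in\mathcal{P}\}\}$. A tope committee is $\mathcal{K}^{\ast}\subset\mathcal{T}$ with $|\{K\in\mathcal{K}^{\ast}:K(e)=+\}|>\tfrac12|\mathcal{K}^{\ast}|$ for all $e\in E$; minimal if no proper subset is a tope committee; a minimal committee $\mathcal{K}^{\ast}$ is critical if for all $K\in\mathcal{K}^{\ast}$ and $T\in\mathcal{T}$ with $T^+\subsetneqq K^+$, $(\mathcal{K}^{\ast}-\{K\})\cup\{T\}$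 is not a tope committee. -}

module Defs where

open import Data.Nat using (ℕ; zero; suc; _+_; _*_; _<_)
open import Data.Fin using (Fin)
open import Data.Bool using (Bool; true; false; _∧_; _∨_; not; if_then_else_)
open import Data.List using (List; []; _∷_; map; concatMap)
open import Data.Vec using (Vec; []; _∷_; lookup; zipWith; replicate)
open import Data.Vec.Properties using (≡-dec)
open import Data.Product using (Σ; ∃; _×_; _,_)
open import Data.Sum using (_⊎_)
open import Relation.Nullary using (¬_; Dec; yes; no)
open import Relation.Nullary.Decidable using (⌊_⌋)
open import Relation.Binary.PropositionalEquality using (_≡_; _≢_; refl)
open import Relation.Binary.Definitions using (DecidableEquality)

data Sign : Set where
  minus zer plus : Sign

neg : Sign → Sign
neg minus = plus
neg zer   = zer
neg plus  = minus

_≟ˢ_ : DecidableEquality Sign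
minus ≟ˢ minus = yes refl
minus ≟ˢ zer   = no λ ()
minus ≟ˢ plus  = no λ ()
zer   ≟ˢ minus = no λ ()
zer   ≟ˢ zer   = yes refl
zer   ≟ˢ plus  = no λ ()
plus  ≟ˢ minus = no λ ()
plus  ≟ˢ zer   = no λ ()
plus  ≟ˢ plus  = yes refl

SV : ℕ → Set
SV n = Vec Sign n

_≟ᵛ_ : ∀ {n} → DecidableEquality (SV n)
_≟ᵛ_ = ≡-dec _≟ˢ_

zeroV : ∀ {n} → SV n
zeroV = replicate _ zer

negV : ∀ {n} → SV n → SV n
negV = Data.Vec.map neg

compS : Sign → Sign → Sign
compS zer   y = y
compS minus _ = minus
compS plus  _ = plus

_∘ᵛ_ : ∀ {n} → SV n → SV n → SV n
_∘ᵛ_ = zipWith compS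

Sep : ∀ {n} → SV n → SV n → Fin n → Set
Sep X Y e = (lookup X e ≡ neg (lookup Y e)) × (lookup X e ≢ zer)

-- Oriented matroids via covector axioms (L0)–(L3).
-- A covector set is a predicate on {-,0,+}^E (automatically finite).

record IsOM {n : ℕ} (L : SV n → Set) : Set where
  field
    L0 : L zeroV
    L1 : ∀ X → L X → L (negV X)
    L2 : ∀ X Y → L X → L Y → L (X ∘ᵛ Y)
    L3 : ∀ X Y e → L X → L Y → Sep X Y e →
         Σ (SV n) λ Z → L Z × (lookup Z e ≡ zer) ×
           (∀ f → ¬ Sep X Y f → lookup Z f ≡ lookup (X ∘ᵛ Y) f)

SuppSub : ∀ {n} → SV n → SV n → Set
SuppSub X Y = ∀ e → lookup X e ≢ zer → lookup Y e ≢ zer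

SuppStrict : ∀ {n} → SV n → SV n → Set
SuppStrict X Y = SuppSub X Y × ∃ λ e → lookup Y e ≢ zer × lookup X e ≡ zer

PlusSub : ∀ {n} → SV n → SV n → Set
PlusSub X Y = ∀ e → lookup X e ≡ plus → lookup Y e ≡ plus

PlusStrict : ∀ {n} → SV n → SV n → Set
PlusStrict X Y = PlusSub X Y × ∃ λ e → lookup Y e ≡ plus × lookup X e ≢ plus

IsTope : ∀ {n} → (SV n → Set) → SV n → Set
IsTope L T = L T × (∀ Y → L Y → ¬ SuppStrict T Y)

Conf : ∀ {n} → SV n → SV n → Set
Conf X Y = ∀ e → (lookup X e ≡ zer) ⊎ (lookup X e ≡ lookup Y e)

ConfStrict : ∀ {n} → SV n → SV n → Set
ConfStrict X Y = Conf X Y × X ≢ Y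

-- rank 2: the longest chain 0 < X₁ < ... < X_r in the covector poset has r = 2
Rank2 : ∀ {n} → (SV n → Set) → Set
Rank2 {n} L =
  (Σ (SV n) λ X₁ → Σ (SV n) λ X₂ → L X₁ × L X₂ ×
      ConfStrict zeroV X₁ × ConfStrict X₁ X₂)
  × ¬ (Σ (SV n) λ X₁ → Σ (SV n) λ X₂ → Σ (SV n) λ X₃ → L X₁ × L X₂ × L X₃ ×
      ConfStrict zeroV X₁ × ConfStrict X₁ X₂ × ConfStrict X₂ X₃)

-- simple: no loops, no parallel, no antiparallel elements
Simple : ∀ {n} → (SV n → Set) → Set
Simple {n} L =
  (∀ e → Σ (SV n) λ T → IsTope L T × lookup T e ≢ zer)
  × (∀ e f → e ≢ f → ¬ (∀ X → L X → lookup X e ≡ lookup X f))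
  × (∀ e f → e ≢ f → ¬ (∀ X → L X → lookup X e ≡ neg (lookup X f)))

-- Finite sets of sign vectors as Bool-valued characteristic functions,
-- counted over the complete enumeration of {-,0,+}^n.

allSV : (n : ℕ) → List (SV n)
allSV zero    = [] ∷ []
allSV (suc n) = concatMap (λ v → (minus ∷ v) ∷ (zer ∷ v) ∷ (plus ∷ v) ∷ []) (allSV n)

countB : ∀ {A : Set} → (A → Bool) → List A → ℕ
countB p []       = 0
countB p (x ∷ xs) = if p x then suc (countB p xs) else countB p xs

SVSet : ℕ → Set
SVSet n = SV n → Bool

_∈ˢ_ : ∀ {n} → SV n → SVSet n → Set
X ∈ˢ S = S X ≡ true

card : ∀ {n} → SVSet n → ℕ
card {n} S = countB S (allSV n)

isPlus : Sign → Bool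
isPlus plus = true
isPlus _    = false

cardPlus : ∀ {n} → SVSet n → Fin n → ℕ
cardPlus {n} S e = countB (λ X → S X ∧ isPlus (lookup X e)) (allSV n)

IsCommittee : ∀ {n} → (SV n → Set) → SVSet n → Set
IsCommittee L S = (∀ X → X ∈ˢ S → IsTope L X) × (∀ e → card S < 2 * cardPlus S e)

IsMinimalCommittee : ∀ {n} → (SV n → Set) → SVSet n → Set
IsMinimalCommittee {n} L S =
  IsCommittee L S ×
  (∀ (S' : SVSet n) → (∀ X → X ∈ˢ S' → X ∈ˢ S) → (∃ λ X → X ∈ˢ S × ¬ X ∈ˢ S') →
     ¬ IsCommittee L S')

replace : ∀ {n} → SVSet n → SV n → SV n → SVSet n
replace S K T X = (S X ∧ not ⌊ X ≟ᵛ K ⌋) ∨ ⌊ X ≟ᵛ T ⌋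

IsCriticalCommittee : ∀ {n} → (SV n → Set) → SVSet n → Set
IsCriticalCommittee L S =
  IsMinimalCommittee L S ×
  (∀ K T → K ∈ˢ S → IsTope L T → PlusStrict T K → ¬ IsCommittee L (replace S K T))

SepIsSingleton : ∀ {n} → SV n → SV n → Fin n → Set
SepIsSingleton K T e = ∀ f → (Sep K T f → f ≡ e) × (f ≡ e → Sep K T f)

InKStar : ∀ {n} → (SV n → Set) → SV n → Set
InKStar L K = IsTope L K × (∀ T e → IsTope L T → SepIsSingleton K T e → lookup K e ≡ plus)

InMaxPlusTopes : ∀ {n} → (SV n → Set) → SV n → Set
InMaxPlusTopes L P = IsTope L P × (∀ R → IsTope L R → ¬ PlusStrict P R)

{-# OPTIONS --safe #-}

-- In a simple rank-2 oriented matroid every nonzero covector that is not a tope vanishes at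
-- exactly one element and is determined up to sign by it; hence every tope T has exactly two
-- neighbours flipAt e T (the tope graph is a cycle).  The members of K* are the peaks: the topes
-- positive at both elements whose flip leads to a neighbour.  Walking from a peak towards any other
-- tope shows that these are the topes with inclusion-maximal positive part, and that no other tope
-- is positive at both neighbouring elements e₁, e₂ of a peak K; so without K the majorities at e₁
-- and e₂ cannot both hold, which gives minimality and criticality.  The peaks do form a committee:
-- fix e and count the pairs (X, f) with X(e) = + and X adjacent at f, by the sign of X(f).  For each
-- tope the number of positive minus negative such f is 2[X is a peak] − 2[−X is a peak]; flipping f
-- matches the two kinds of pairs for f ≠ e, while for f = e only positive pairs exist, and some do.
-- Hence more peaks are positive than negative at e.

module Submission where

open import Defs
open import Data.Bool using (Bool; true; false; _∧_)
open import Data.Bool.Properties using (∧-zeroʳ; ∧-identityʳ; ∨-identityʳ; ¬-not)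
open import Data.Empty using (⊥; ⊥-elim)
open import Data.Fin as Fin using (Fin; _≟_; punchIn)
open import Data.Fin.Properties using (any?; ¬∀⟶∃¬; punchInᵢ≢i)
open import Data.List using (List; []; _∷_; _++_; map; concatMap)
open import Data.List.Membership.Propositional using (_∈_)
open import Data.List.Membership.Propositional.Properties using (∈-concatMap⁺; ∈-map⁺)
open import Data.List.Properties using (map-++; map-cong)
open import Data.List.Relation.Unary.Any as Any using (here; there)
open import Data.Nat using (ℕ; zero; suc; _+_; _*_; _≤_; _<_; z≤n; _<?_)
open import Data.Nat.Induction using (<-wellFounded)
open import Data.Nat.ListAction using (sum)
open import Data.Nat.ListAction.Properties using (sum-++)
open import Data.Nat.Properties
  using ( +-identityʳ; *-identityˡ; *-zeroʳ; *-distribˡ-+; ≤-refl; ≤-trans; ≤-reflexive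
        ; +-mono-≤; +-mono-<; +-mono-<-≤; +-monoʳ-<; *-monoʳ-≤; m≤m+n; m≤n⇒m≤o+n; <-irrefl; ≮⇒≥
        ; +-commutativeSemigroup; +-*-semiring; module ≤-Reasoning)
open import Data.Product using (Σ; ∃; ∃₂; _×_; _,_; proj₁; proj₂)
open import Data.Sum using (_⊎_; inj₁; inj₂; [_,_]′)
open import Data.Vec as Vec using (_∷_; lookup; updateAt; _[_]≔_)
import Data.Vec.Properties as Vecₚ
open import Function using (_∘_; id)
open import Function.Bundles using (_⇔_; mk⇔; Equivalence)
import Function.Properties.Equivalence as ⇔
open import Induction.WellFounded using (Acc; acc)
open import Relation.Binary.PropositionalEquality
open import Relation.Nullary using (¬_; Dec; yes; no; contradiction)
open import Relation.Nullary.Decidable using (does; dec-true; dec-false; does-⇔)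
open import Algebra.Properties.CommutativeSemigroup +-commutativeSemigroup using (interchange; x∙yz≈z∙yx)
open import Algebra.Properties.Semiring.Sum +-*-semiring
  using (sum-syntax; ∑-distrib-+; *-distribˡ-sum; sum-cong-≗; sum-replicate-zero; sum-remove)

-- Signs and sign vectors

neg-involutive : ∀ s → neg (neg s) ≡ s
neg-involutive minus = refl
neg-involutive zer   = refl
neg-involutive plus  = refl

≡neg⇒≡zer : ∀ {s} → s ≡ neg s → s ≡ zer
≡neg⇒≡zer {minus} ()
≡neg⇒≡zer {zer}   _ = refl
≡neg⇒≡zer {plus}  ()

≡neg-sym : ∀ {s t} → s ≡ neg t → t ≡ neg s
≡neg-sym {s} {t} s≡-t = trans (sym (neg-involutive t)) (cong neg (sym s≡-t))

neg-≢zer : ∀ {s} → s ≢ zer → neg s ≢ zer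
neg-≢zer {s} s≢0 -s≡0 = s≢0 (trans (sym (neg-involutive s)) (cong neg -s≡0))

≢zer⇒≡⊎≡neg : ∀ {s t} → s ≢ zer → t ≢ zer → s ≡ t ⊎ s ≡ neg t
≢zer⇒≡⊎≡neg {minus} {minus} _ _ = inj₁ refl
≢zer⇒≡⊎≡neg {minus} {plus}  _ _ = inj₂ refl
≢zer⇒≡⊎≡neg {plus}  {minus} _ _ = inj₂ refl
≢zer⇒≡⊎≡neg {plus}  {plus}  _ _ = inj₁ refl
≢zer⇒≡⊎≡neg {zer}           s≢0 _   = contradiction refl s≢0
≢zer⇒≡⊎≡neg {minus} {zer}   _   t≢0 = contradiction refl t≢0
≢zer⇒≡⊎≡neg {plus}  {zer}   _   t≢0 = contradiction refl t≢0

≢zer∧≢plus⇒≡minus : ∀ {s} → s ≢ zer → s ≢ plus → s ≡ minus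
≢zer∧≢plus⇒≡minus {minus} _   _   = refl
≢zer∧≢plus⇒≡minus {zer}   s≢0 _   = contradiction refl s≢0
≢zer∧≢plus⇒≡minus {plus}  _   s≢+ = contradiction refl s≢+

compS-≢zerˡ : ∀ {s} t → s ≢ zer → compS s t ≡ s
compS-≢zerˡ {minus} _ _   = refl
compS-≢zerˡ {zer}   _ s≢0 = contradiction refl s≢0
compS-≢zerˡ {plus}  _ _   = refl

compS-≢zerʳ : ∀ s {t} → t ≢ zer → compS s t ≢ zer
compS-≢zerʳ minus _   ()
compS-≢zerʳ zer   t≢0 = t≢0
compS-≢zerʳ plus  _   ()

isMinus : Sign → Bool
isMinus minus = true
isMinus _     = false

isPlus⇒≡plus : ∀ {s} → isPlus s ≡ true → s ≡ plus
isPlus⇒≡plus {plus} _ = refl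

isPlus-neg : ∀ s → isPlus (neg s) ≡ isMinus s
isPlus-neg minus = refl
isPlus-neg zer   = refl
isPlus-neg plus  = refl

isMinus-neg : ∀ s → isMinus (neg s) ≡ isPlus s
isMinus-neg minus = refl
isMinus-neg zer   = refl
isMinus-neg plus  = refl

isPlus∧isPlus⇔ : ∀ {s t} → (s ≡ plus × t ≡ plus) ⇔ (isPlus s ∧ isPlus t ≡ true)
isPlus∧isPlus⇔ {s} {t} = mk⇔ (λ { (refl , refl) → refl }) both-plus
  where
  both-plus : isPlus s ∧ isPlus t ≡ true → s ≡ plus × t ≡ plus
  both-plus st with isPlus s in s-plus | isPlus t in t-plus
  ... | true | true = isPlus⇒≡plus s-plus , isPlus⇒≡plus t-plus

module _ {n : ℕ} where

  lookup-ext : {X Y : SV n} → (∀ e → lookup X e ≡ lookup Y e) → X ≡ Y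
  lookup-ext {X} {Y} X≗Y = begin
    X                     ≡⟨ Vecₚ.tabulate∘lookup X ⟨
    Vec.tabulate (lookup X) ≡⟨ Vecₚ.tabulate-cong X≗Y ⟩
    Vec.tabulate (lookup Y) ≡⟨ Vecₚ.tabulate∘lookup Y ⟩
    Y                     ∎
    where open ≡-Reasoning

  ≢⇒∃-lookup-≢ : {X Y : SV n} → X ≢ Y → ∃ λ e → lookup X e ≢ lookup Y e
  ≢⇒∃-lookup-≢ {X} {Y} X≢Y =
    ¬∀⟶∃¬ n _ (λ e → lookup X e ≟ˢ lookup Y e) (X≢Y ∘ lookup-ext)

  lookup-negV : ∀ (X : SV n) e → lookup (negV X) e ≡ neg (lookup X e)
  lookup-negV X e = Vecₚ.lookup-map e neg X

  lookup-∘ᵛ : ∀ (X Y : SV n) e → lookup (X ∘ᵛ Y) e ≡ compS (lookup X e) (lookup Y e)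
  lookup-∘ᵛ X Y e = Vecₚ.lookup-zipWith compS e X Y

  lookup-zeroV : ∀ e → lookup (zeroV {n}) e ≡ zer
  lookup-zeroV e = Vecₚ.lookup-replicate e zer

  ≢zeroV⇒∃-≢zer : {X : SV n} → X ≢ zeroV → ∃ λ e → lookup X e ≢ zer
  ≢zeroV⇒∃-≢zer X≢0 with ≢⇒∃-lookup-≢ X≢0
  ... | e , Xe≢0e = e , λ Xe≡0 → Xe≢0e (trans Xe≡0 (sym (lookup-zeroV e)))

  ≢zer⇒≢zeroV : {X : SV n} {e : Fin n} → lookup X e ≢ zer → X ≢ zeroV
  ≢zer⇒≢zeroV {e = e} Xe≢0 refl = Xe≢0 (lookup-zeroV e)

  negV-involutive : (X : SV n) → negV (negV X) ≡ X
  negV-involutive X = lookup-ext λ e → begin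
    lookup (negV (negV X)) e ≡⟨ lookup-negV (negV X) e ⟩
    neg (lookup (negV X) e)  ≡⟨ cong neg (lookup-negV X e) ⟩
    neg (neg (lookup X e))   ≡⟨ neg-involutive _ ⟩
    lookup X e               ∎
    where open ≡-Reasoning

  ∘ᵛ-≢zerˡ : ∀ (X Y : SV n) {e} → lookup X e ≢ zer → lookup (X ∘ᵛ Y) e ≡ lookup X e
  ∘ᵛ-≢zerˡ X Y {e} Xe≢0 = trans (lookup-∘ᵛ X Y e) (compS-≢zerˡ _ Xe≢0)

  ∘ᵛ-zerˡ : ∀ (X Y : SV n) {e} → lookup X e ≡ zer → lookup (X ∘ᵛ Y) e ≡ lookup Y e
  ∘ᵛ-zerˡ X Y {e} Xe≡0 = trans (lookup-∘ᵛ X Y e) (cong (λ s → compS s _) Xe≡0)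

  Full : SV n → Set
  Full X = ∀ e → lookup X e ≢ zer

  full⊎∃zer : (X : SV n) → Full X ⊎ ∃ λ e → lookup X e ≡ zer
  full⊎∃zer X with any? (λ e → lookup X e ≟ˢ zer)
  ... | yes ∃zer = inj₂ ∃zer
  ... | no ¬∃zer = inj₁ λ e Xe≡0 → ¬∃zer (e , Xe≡0)

  ∘ᵛ-full : ∀ X {Y : SV n} → Full Y → Full (X ∘ᵛ Y)
  ∘ᵛ-full X {Y} fullY e XYe≡0 = compS-≢zerʳ (lookup X e) (fullY e) (trans (sym (lookup-∘ᵛ X Y e)) XYe≡0)

  negV-full : ∀ (X : SV n) → Full X → Full (negV X)
  negV-full X fullX e -Xe≡0 = neg-≢zer (fullX e) (trans (sym (lookup-negV X e)) -Xe≡0)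

  conf-∘ᵛ : ∀ (X Y : SV n) → Conf X (X ∘ᵛ Y)
  conf-∘ᵛ X Y e with lookup X e ≟ˢ zer
  ... | yes Xe≡0 = inj₁ Xe≡0
  ... | no  Xe≢0 = inj₂ (sym (∘ᵛ-≢zerˡ X Y Xe≢0))

  conf-lookup : ∀ (X Y : SV n) → Conf X Y → ∀ {e} → lookup X e ≢ zer → lookup Y e ≡ lookup X e
  conf-lookup X Y X≤Y {e} Xe≢0 with X≤Y e
  ... | inj₁ Xe≡0 = contradiction Xe≡0 Xe≢0
  ... | inj₂ Xe≡Ye = sym Xe≡Ye

  conf-full⇒≡ : ∀ (X Y : SV n) → Conf X Y → Full X → X ≡ Y
  conf-full⇒≡ X Y X≤Y fullX = lookup-ext λ e → sym (conf-lookup X Y X≤Y (fullX e))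

  ≡⇒¬Sep : ∀ (X Y : SV n) {e} → lookup X e ≡ lookup Y e → ¬ Sep X Y e
  ≡⇒¬Sep X Y Xe≡Ye (Xe≡-Ye , Xe≢0) = Xe≢0 (≡neg⇒≡zer (trans Xe≡-Ye (cong neg (sym Xe≡Ye))))

  zer⇒¬Sep : ∀ (X Y : SV n) {e} → lookup X e ≡ zer → ¬ Sep X Y e
  zer⇒¬Sep X Y Xe≡0 (_ , Xe≢0) = Xe≢0 Xe≡0

  full⇒Sep : ∀ (X Y : SV n) → Full X → Full Y → ∀ {e} → lookup X e ≢ lookup Y e → Sep X Y e
  full⇒Sep X Y fullX fullY {e} Xe≢Ye with ≢zer⇒≡⊎≡neg (fullX e) (fullY e)
  ... | inj₁ Xe≡Ye  = contradiction Xe≡Ye Xe≢Ye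
  ... | inj₂ Xe≡-Ye = Xe≡-Ye , fullX e

  Sep? : ∀ (X Y : SV n) e → Dec (Sep X Y e)
  Sep? X Y e with lookup X e ≟ˢ neg (lookup Y e) | lookup X e ≟ˢ zer
  ... | yes Xe≡-Ye | no Xe≢0 = yes (Xe≡-Ye , Xe≢0)
  ... | no Xe≢-Ye  | _       = no λ sep → Xe≢-Ye (proj₁ sep)
  ... | yes _      | yes Xe≡0 = no (zer⇒¬Sep X Y Xe≡0)

  flipAt : Fin n → SV n → SV n
  flipAt e X = updateAt X e neg

  zeroAt : Fin n → SV n → SV n
  zeroAt e X = X [ e ]≔ zer

  lookup-flipAt : ∀ e (X : SV n) → lookup (flipAt e X) e ≡ neg (lookup X e)
  lookup-flipAt e X = Vecₚ.lookup∘updateAt e X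

  lookup-flipAt-≢ : ∀ {e f} (X : SV n) → f ≢ e → lookup (flipAt e X) f ≡ lookup X f
  lookup-flipAt-≢ {e} {f} X f≢e = Vecₚ.lookup∘updateAt′ f e f≢e X

  lookup-zeroAt : ∀ e (X : SV n) → lookup (zeroAt e X) e ≡ zer
  lookup-zeroAt e X = Vecₚ.lookup∘updateAt e X

  lookup-zeroAt-≢ : ∀ {e f} (X : SV n) → f ≢ e → lookup (zeroAt e X) f ≡ lookup X f
  lookup-zeroAt-≢ {e} {f} X f≢e = Vecₚ.lookup∘updateAt′ f e f≢e X

  flipAt-involutive : ∀ e (X : SV n) → flipAt e (flipAt e X) ≡ X
  flipAt-involutive e X =
    trans (Vecₚ.updateAt-updateAt-local e X (neg-involutive _)) (Vecₚ.updateAt-id e X)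

  zeroAt-flipAt : ∀ e (X : SV n) → zeroAt e (flipAt e X) ≡ zeroAt e X
  zeroAt-flipAt e X = Vecₚ.updateAt-updateAt e X

  negV-flipAt : ∀ e (X : SV n) → negV (flipAt e X) ≡ flipAt e (negV X)
  negV-flipAt e X = Vecₚ.map-updateAt X e refl

  Sep-flipAt : ∀ (X : SV n) {e} → lookup X e ≢ zer → Sep X (flipAt e X) e
  Sep-flipAt X {e} Xe≢0 = ≡neg-sym (lookup-flipAt e X) , Xe≢0

  flipAt-full : ∀ e (X : SV n) → Full X → Full (flipAt e X)
  flipAt-full e X fullX f with f ≟ e
  ... | yes refl = neg-≢zer (fullX e) ∘ trans (sym (lookup-flipAt e X))
  ... | no f≢e   = fullX f ∘ trans (sym (lookup-flipAt-≢ X f≢e))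

  ¬Sep⇒≡ : ∀ (X Y : SV n) → Full X → Full Y → ∀ {e} → ¬ Sep X Y e → lookup X e ≡ lookup Y e
  ¬Sep⇒≡ X Y fullX fullY {e} ¬sep with lookup X e ≟ˢ lookup Y e
  ... | yes Xe≡Ye = Xe≡Ye
  ... | no Xe≢Ye  = contradiction (full⇒Sep X Y fullX fullY Xe≢Ye) ¬sep

  ≡neg-at⇒≢ : ∀ {X Y : SV n} {e} → lookup X e ≢ zer → lookup Y e ≡ neg (lookup X e) → X ≢ Y
  ≡neg-at⇒≢ Xe≢0 Ye≡-Xe refl = Xe≢0 (≡neg⇒≡zer Ye≡-Xe)

-- Counting

𝟙 : Bool → ℕ
𝟙 true  = 1
𝟙 false = 0

𝟙-does-mono : ∀ {P Q : Set} → (P → Q) → (p : Dec P) (q : Dec Q) → 𝟙 (does p) ≤ 𝟙 (does q)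
𝟙-does-mono P⇒Q (yes p) (yes _) = ≤-refl
𝟙-does-mono P⇒Q (yes p) (no ¬q) = contradiction (P⇒Q p) ¬q
𝟙-does-mono P⇒Q (no _)  q       = z≤n

𝟙-isPlus+𝟙-isMinus : ∀ {s} → s ≢ zer → 𝟙 (isPlus s) + 𝟙 (isMinus s) ≡ 1
𝟙-isPlus+𝟙-isMinus {minus} _   = refl
𝟙-isPlus+𝟙-isMinus {zer}   s≢0 = contradiction refl s≢0
𝟙-isPlus+𝟙-isMinus {plus}  _   = refl

𝟙-isPlus*𝟙-∧-isMinus : ∀ s b → 𝟙 (isPlus s) * 𝟙 (b ∧ isMinus s) ≡ 0
𝟙-isPlus*𝟙-∧-isMinus minus b = refl
𝟙-isPlus*𝟙-∧-isMinus zer   b = refl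
𝟙-isPlus*𝟙-∧-isMinus plus  b = cong (λ c → 𝟙 c + 0) (∧-zeroʳ b)

𝟙-*-+ : ∀ a x b → 𝟙 a * (x + 2 * 𝟙 b) ≡ 𝟙 a * x + 2 * 𝟙 (b ∧ a)
𝟙-*-+ true  x b = trans (*-identityˡ _) (cong₂ (λ y c → y + 2 * 𝟙 c) (sym (*-identityˡ x)) (sym (∧-identityʳ b)))
𝟙-*-+ false x b = cong (λ c → 2 * 𝟙 c) (sym (∧-zeroʳ b))

sign-balance : ∀ {s t} → s ≢ zer → t ≢ zer →
  𝟙 (isPlus s) + 𝟙 (isPlus t) + 2 * 𝟙 (isMinus s ∧ isMinus t) ≡
  𝟙 (isMinus s) + 𝟙 (isMinus t) + 2 * 𝟙 (isPlus s ∧ isPlus t)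
sign-balance {minus} {minus} _ _ = refl
sign-balance {minus} {plus}  _ _ = refl
sign-balance {plus}  {minus} _ _ = refl
sign-balance {plus}  {plus}  _ _ = refl
sign-balance {zer}           s≢0 _   = contradiction refl s≢0
sign-balance {minus} {zer}   _   t≢0 = contradiction refl t≢0
sign-balance {plus}  {zer}   _   t≢0 = contradiction refl t≢0

≡true⇔≡true⇒≡ : ∀ {a b : Bool} → (a ≡ true ⇔ b ≡ true) → a ≡ b
≡true⇔≡true⇒≡ {false} {false} _   = refl
≡true⇔≡true⇒≡ {false} {true}  a⇔b = Equivalence.from a⇔b refl
≡true⇔≡true⇒≡ {true}  {false} a⇔b = sym (Equivalence.to a⇔b refl)
≡true⇔≡true⇒≡ {true}  {true}  _   = refl

two-majorities⇒⊥ : ∀ {a b c} → a + b ≤ c → c < 2 * a → c < 2 * b → ⊥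
two-majorities⇒⊥ {a} {b} {c} a+b≤c c<2a c<2b = <-irrefl refl (begin-strict
  c + c            <⟨ +-mono-< c<2a c<2b ⟩
  2 * a + 2 * b    ≡⟨ *-distribˡ-+ 2 a b ⟨
  2 * (a + b)      ≤⟨ *-monoʳ-≤ 2 a+b≤c ⟩
  2 * c            ≡⟨ cong (c +_) (+-identityʳ c) ⟩
  c + c            ∎)
  where open ≤-Reasoning

balance⇒< : ∀ {d u m p} → d + 2 * m ≡ u + 2 * p → u < d → m < p
balance⇒< {d} {u} {m} {p} balance u<d with m <? p
... | yes m<p = m<p
... | no m≮p  = contradiction (+-mono-<-≤ u<d (*-monoʳ-≤ 2 (≮⇒≥ m≮p))) (<-irrefl (sym balance))

module _ {A : Set} where

  countB≡sum : ∀ (p : A → Bool) xs → countB p xs ≡ sum (map (𝟙 ∘ p) xs)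
  countB≡sum p []       = refl
  countB≡sum p (x ∷ xs) with p x
  ... | true  = cong suc (countB≡sum p xs)
  ... | false = countB≡sum p xs

  sum-map-+ : ∀ (f g : A → ℕ) xs →
              sum (map (λ x → f x + g x) xs) ≡ sum (map f xs) + sum (map g xs)
  sum-map-+ f g []       = refl
  sum-map-+ f g (x ∷ xs) =
    trans (cong (f x + g x +_) (sum-map-+ f g xs)) (interchange (f x) (g x) (sum (map f xs)) _)

  sum-map-*ˡ : ∀ k (f : A → ℕ) xs → sum (map (λ x → k * f x) xs) ≡ k * sum (map f xs)
  sum-map-*ˡ k f []       = sym (*-zeroʳ k)
  sum-map-*ˡ k f (x ∷ xs) =
    trans (cong (k * f x +_) (sum-map-*ˡ k f xs)) (sym (*-distribˡ-+ k (f x) _))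

  sum-map-mono-≤ : ∀ {f g : A → ℕ} → (∀ x → f x ≤ g x) → ∀ xs → sum (map f xs) ≤ sum (map g xs)
  sum-map-mono-≤ f≤g []       = ≤-refl
  sum-map-mono-≤ f≤g (x ∷ xs) = +-mono-≤ (f≤g x) (sum-map-mono-≤ f≤g xs)

  sum-map-zero : ∀ {f : A → ℕ} → (∀ x → f x ≡ 0) → ∀ xs → sum (map f xs) ≡ 0
  sum-map-zero f≗0 []       = refl
  sum-map-zero f≗0 (x ∷ xs) = cong₂ _+_ (f≗0 x) (sum-map-zero f≗0 xs)

  ∈⇒≤sum-map : ∀ (f : A → ℕ) {x xs} → x ∈ xs → f x ≤ sum (map f xs)
  ∈⇒≤sum-map f (here refl)  = m≤m+n _ _
  ∈⇒≤sum-map f (there x∈xs) = m≤n⇒m≤o+n _ (∈⇒≤sum-map f x∈xs)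

  sum-map-concatMap : ∀ {B : Set} (f : B → ℕ) (g : A → List B) xs →
    sum (map f (concatMap g xs)) ≡ sum (map (λ x → sum (map f (g x))) xs)
  sum-map-concatMap f g []       = refl
  sum-map-concatMap f g (x ∷ xs) = begin
    sum (map f (g x ++ concatMap g xs))
      ≡⟨ cong sum (map-++ f (g x) _) ⟩
    sum (map f (g x) ++ map f (concatMap g xs))
      ≡⟨ sum-++ (map f (g x)) _ ⟩
    sum (map f (g x)) + sum (map f (concatMap g xs))
      ≡⟨ cong (sum (map f (g x)) +_) (sum-map-concatMap f g xs) ⟩
    sum (map f (g x)) + sum (map (λ x → sum (map f (g x))) xs) ∎
    where open ≡-Reasoning

  sum-map-∑ : ∀ {m} (g : A → Fin m → ℕ) xs →
    sum (map (λ x → ∑[ i < m ] g x i) xs) ≡ ∑[ i < m ] sum (map (λ x → g x i) xs)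
  sum-map-∑ {m} g []       = sym (sum-replicate-zero m)
  sum-map-∑ {m} g (x ∷ xs) =
    trans (cong (∑[ i < m ] g x i +_) (sum-map-∑ g xs)) (sym (∑-distrib-+ (g x) _))

∑-zero : ∀ {m} {f : Fin m → ℕ} → (∀ i → f i ≡ 0) → ∑[ i < m ] f i ≡ 0
∑-zero {m} f≗0 = trans (sum-cong-≗ f≗0) (sum-replicate-zero m)

∑-delta : ∀ {m} (f : Fin m → ℕ) i → (∀ j → j ≢ i → f j ≡ 0) → ∑[ j < m ] f j ≡ f i
∑-delta {suc m} f i f≗0 = begin
  ∑[ j < suc m ] f j                       ≡⟨ sum-remove {i = i} f ⟩
  f i + ∑[ j < m ] f (punchIn i j)         ≡⟨ cong (f i +_) (∑-zero λ j → f≗0 _ (punchInᵢ≢i i j)) ⟩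
  f i + 0                                  ≡⟨ +-identityʳ (f i) ⟩
  f i                                      ∎
  where open ≡-Reasoning

∑-mono-≤ : ∀ {m} {f g : Fin m → ℕ} → (∀ i → f i ≤ g i) → ∑[ i < m ] f i ≤ ∑[ i < m ] g i
∑-mono-≤ {zero}  f≤g = ≤-refl
∑-mono-≤ {suc m} f≤g = +-mono-≤ (f≤g Fin.zero) (∑-mono-≤ (f≤g ∘ Fin.suc))

∑-mono-< : ∀ {m} {f g : Fin m → ℕ} → (∀ i → f i ≤ g i) → ∀ i → f i < g i →
           ∑[ j < m ] f j < ∑[ j < m ] g j
∑-mono-< {suc m} {f} {g} f≤g i fi<gi = begin-strict
  ∑[ j < suc m ] f j                 ≡⟨ sum-remove {i = i} f ⟩
  f i + ∑[ j < m ] f (punchIn i j)   <⟨ +-mono-<-≤ fi<gi (∑-mono-≤ (f≤g ∘ punchIn i)) ⟩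
  g i + ∑[ j < m ] g (punchIn i j)   ≡⟨ sum-remove {i = i} g ⟨
  ∑[ j < suc m ] g j                 ∎
  where open ≤-Reasoning

signs : List Sign
signs = minus ∷ zer ∷ plus ∷ []

∑ˢ : (Sign → ℕ) → ℕ
∑ˢ g = sum (map g signs)

∑ˢ-neg : ∀ g → ∑ˢ g ≡ ∑ˢ (g ∘ neg)
∑ˢ-neg g = begin
  g minus + (g zer + (g plus + 0))  ≡⟨ cong (λ x → g minus + (g zer + x)) (+-identityʳ (g plus)) ⟩
  g minus + (g zer + g plus)        ≡⟨ x∙yz≈z∙yx (g minus) (g zer) (g plus) ⟩
  g plus + (g zer + g minus)        ≡⟨ cong (λ x → g plus + (g zer + x)) (+-identityʳ (g minus)) ⟨
  g plus + (g zer + (g minus + 0))  ∎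
  where open ≡-Reasoning

∈-signs : ∀ s → s ∈ signs
∈-signs minus = here refl
∈-signs zer   = there (here refl)
∈-signs plus  = there (there (here refl))

∈-allSV : ∀ {n} (X : SV n) → X ∈ allSV n
∈-allSV {zero}  Vec.[]  = here refl
∈-allSV {suc n} (s ∷ X) = ∈-concatMap⁺ (λ Y → map (_∷ Y) signs) (Any.map (λ { refl → ∈-map⁺ (_∷ X) (∈-signs s) }) (∈-allSV X))

∑ᵛ : ∀ {n} → (SV n → ℕ) → ℕ
∑ᵛ {n} h = sum (map h (allSV n))

∑ᵛ-∷ : ∀ {n} (h : SV (suc n) → ℕ) → ∑ᵛ h ≡ ∑ᵛ (λ X → ∑ˢ (λ s → h (s ∷ X)))
∑ᵛ-∷ {n} h = sum-map-concatMap h (λ X → map (_∷ X) signs) (allSV n)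

∑ᵛ-cong : ∀ {n} {g h : SV n → ℕ} → (∀ X → g X ≡ h X) → ∑ᵛ g ≡ ∑ᵛ h
∑ᵛ-cong {n} g≗h = cong sum (map-cong g≗h (allSV n))

∑ᵛ-+-* : ∀ {n} (f g : SV n → ℕ) k → ∑ᵛ (λ X → f X + k * g X) ≡ ∑ᵛ f + k * ∑ᵛ g
∑ᵛ-+-* {n} f g k =
  trans (sum-map-+ f (λ X → k * g X) (allSV n)) (cong (∑ᵛ f +_) (sum-map-*ˡ k g (allSV n)))

∑ᵛ-negV : ∀ {n} (h : SV n → ℕ) → ∑ᵛ h ≡ ∑ᵛ (h ∘ negV)
∑ᵛ-negV {zero}  h = refl
∑ᵛ-negV {suc n} h = begin
  ∑ᵛ h                                            ≡⟨ ∑ᵛ-∷ h ⟩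
  ∑ᵛ (λ X → ∑ˢ (λ s → h (s ∷ X)))                 ≡⟨ ∑ᵛ-negV (λ X → ∑ˢ (λ s → h (s ∷ X))) ⟩
  ∑ᵛ (λ X → ∑ˢ (λ s → h (s ∷ negV X)))            ≡⟨ ∑ᵛ-cong (λ X → ∑ˢ-neg (λ s → h (s ∷ negV X))) ⟩
  ∑ᵛ (λ X → ∑ˢ (λ s → h (neg s ∷ negV X)))        ≡⟨ ∑ᵛ-∷ (h ∘ negV) ⟨
  ∑ᵛ (h ∘ negV)                                   ∎
  where open ≡-Reasoning

∑ᵛ-flipAt : ∀ {n} (e : Fin n) (h : SV n → ℕ) → ∑ᵛ h ≡ ∑ᵛ (h ∘ flipAt e)
∑ᵛ-flipAt {suc n} Fin.zero h =
  trans (∑ᵛ-∷ h) (trans (∑ᵛ-cong (λ X → ∑ˢ-neg (λ s → h (s ∷ X)))) (sym (∑ᵛ-∷ (h ∘ flipAt Fin.zero))))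
∑ᵛ-flipAt {suc n} (Fin.suc e) h =
  trans (∑ᵛ-∷ h) (trans (∑ᵛ-flipAt e (λ X → ∑ˢ (λ s → h (s ∷ X)))) (sym (∑ᵛ-∷ (h ∘ flipAt (Fin.suc e)))))

sepCount : ∀ {n} → SV n → SV n → ℕ
sepCount {n} X Y = ∑[ f < n ] 𝟙 (does (Sep? X Y f))

sepCount-< : ∀ {n} (X Y Y′ : SV n) {e} → (∀ f → Sep X Y′ f → Sep X Y f) →
             Sep X Y e → ¬ Sep X Y′ e → sepCount X Y′ < sepCount X Y
sepCount-< X Y Y′ {e} narrower sep ¬sep′ =
  ∑-mono-< (λ f → 𝟙-does-mono (narrower f) (Sep? X Y′ f) (Sep? X Y f)) e strict
  where
  strict : 𝟙 (does (Sep? X Y′ e)) < 𝟙 (does (Sep? X Y e))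
  strict rewrite dec-false (Sep? X Y′ e) ¬sep′ | dec-true (Sep? X Y e) sep = ≤-refl

card≡cardPlus+cardPlus∘negV : ∀ {n} (S : SVSet n) e → (∀ X → X ∈ˢ S → lookup X e ≢ zer) →
                               card S ≡ cardPlus S e + cardPlus (S ∘ negV) e
card≡cardPlus+cardPlus∘negV {n} S e nonzero = begin
  card S
    ≡⟨ countB≡sum S (allSV n) ⟩
  ∑ᵛ (λ X → 𝟙 (S X))
    ≡⟨ ∑ᵛ-cong split ⟩
  ∑ᵛ (λ X → 𝟙 (S X ∧ isPlus (lookup X e)) + 𝟙 (S X ∧ isMinus (lookup X e)))
    ≡⟨ sum-map-+ (λ X → 𝟙 (S X ∧ isPlus (lookup X e))) (λ X → 𝟙 (S X ∧ isMinus (lookup X e))) (allSV n) ⟩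
  positives + ∑ᵛ (λ X → 𝟙 (S X ∧ isMinus (lookup X e)))
    ≡⟨ cong (positives +_) (∑ᵛ-negV (λ X → 𝟙 (S X ∧ isMinus (lookup X e)))) ⟩
  positives + ∑ᵛ (λ X → 𝟙 (S (negV X) ∧ isMinus (lookup (negV X) e)))
    ≡⟨ cong (positives +_) (∑ᵛ-cong minus⇒plus) ⟩
  positives + ∑ᵛ (λ X → 𝟙 (S (negV X) ∧ isPlus (lookup X e)))
    ≡⟨ cong₂ _+_ (countB≡sum _ (allSV n)) (countB≡sum _ (allSV n)) ⟨
  cardPlus S e + cardPlus (S ∘ negV) e ∎
  where
  open ≡-Reasoning
  positives : ℕ
  positives = ∑ᵛ (λ X → 𝟙 (S X ∧ isPlus (lookup X e)))
  split : ∀ X → 𝟙 (S X) ≡ 𝟙 (S X ∧ isPlus (lookup X e)) + 𝟙 (S X ∧ isMinus (lookup X e))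
  split X with S X in X∈S
  ... | false = refl
  ... | true  = sym (𝟙-isPlus+𝟙-isMinus (nonzero X X∈S))
  minus⇒plus : ∀ X → 𝟙 (S (negV X) ∧ isMinus (lookup (negV X) e)) ≡ 𝟙 (S (negV X) ∧ isPlus (lookup X e))
  minus⇒plus X = trans (cong (λ s → 𝟙 (S (negV X) ∧ isMinus s)) (lookup-negV X e))
                       (cong (λ b → 𝟙 (S (negV X) ∧ b)) (isMinus-neg (lookup X e)))

cardPlus+cardPlus≤card : ∀ {n} (S : SVSet n) e₁ e₂ →
  (∀ X → X ∈ˢ S → lookup X e₁ ≡ plus → lookup X e₂ ≡ plus → ⊥) →
  cardPlus S e₁ + cardPlus S e₂ ≤ card S
cardPlus+cardPlus≤card {n} S e₁ e₂ exclusive = begin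
  cardPlus S e₁ + cardPlus S e₂
    ≡⟨ cong₂ _+_ (countB≡sum _ (allSV n)) (countB≡sum _ (allSV n)) ⟩
  ∑ᵛ (λ X → 𝟙 (S X ∧ isPlus (lookup X e₁))) + ∑ᵛ (λ X → 𝟙 (S X ∧ isPlus (lookup X e₂)))
    ≡⟨ sum-map-+ (λ X → 𝟙 (S X ∧ isPlus (lookup X e₁))) (λ X → 𝟙 (S X ∧ isPlus (lookup X e₂))) (allSV n) ⟨
  ∑ᵛ (λ X → 𝟙 (S X ∧ isPlus (lookup X e₁)) + 𝟙 (S X ∧ isPlus (lookup X e₂)))
    ≤⟨ sum-map-mono-≤ at-most-once (allSV n) ⟩
  ∑ᵛ (λ X → 𝟙 (S X))
    ≡⟨ countB≡sum S (allSV n) ⟨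
  card S ∎
  where
  open ≤-Reasoning
  at-most-once : ∀ X → 𝟙 (S X ∧ isPlus (lookup X e₁)) + 𝟙 (S X ∧ isPlus (lookup X e₂)) ≤ 𝟙 (S X)
  at-most-once X with S X in X∈S | isPlus (lookup X e₁) in plus₁ | isPlus (lookup X e₂) in plus₂
  ... | false | _     | _     = z≤n
  ... | true  | true  | true  = ⊥-elim (exclusive X X∈S (isPlus⇒≡plus plus₁) (isPlus⇒≡plus plus₂))
  ... | true  | true  | false = ≤-refl
  ... | true  | false | true  = ≤-refl
  ... | true  | false | false = z≤n

replace-removes : ∀ {n} (S : SVSet n) {K T} → K ≢ T → replace S K T K ≡ false
replace-removes S {K} {T} K≢T with K ≟ᵛ K | K ≟ᵛ T
... | yes _   | no _    = trans (∨-identityʳ _) (∧-zeroʳ (S K))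
... | no K≢K  | _       = contradiction refl K≢K
... | yes _   | yes K≡T = contradiction K≡T K≢T

-- Covectors of an oriented matroid

full⇒tope : ∀ {n} {L : SV n → Set} {X} → L X → Full X → IsTope L X
full⇒tope LX fullX = LX , λ { _ _ (_ , e , _ , Xe≡0) → fullX e Xe≡0 }

Loopless : ∀ {n} → (SV n → Set) → Set
Loopless {n} L = ∀ e → Σ (SV n) λ T → IsTope L T × lookup T e ≢ zer

module Covectors {n} {L : SV n → Set} (om : IsOM L) (loopless : Loopless L) where
  open IsOM om

  tope⇒full : ∀ {T} → IsTope L T → Full T
  tope⇒full {T} (LT , maximal) e Te≡0 with loopless e
  ... | T′ , (LT′ , _) , T′e≢0 =
    maximal (T ∘ᵛ T′) (L2 T T′ LT LT′) (support-grows , e , T′e≢0 ∘ trans (sym (∘ᵛ-zerˡ T T′ Te≡0)) , Te≡0)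
    where
    support-grows : SuppSub T (T ∘ᵛ T′)
    support-grows f Tf≢0 = Tf≢0 ∘ trans (sym (∘ᵛ-≢zerˡ T T′ Tf≢0))

  ∘ᵛ-tope : ∀ {X T} → L X → IsTope L T → IsTope L (X ∘ᵛ T)
  ∘ᵛ-tope {X} {T} LX tT = full⇒tope (L2 X T LX (proj₁ tT)) (∘ᵛ-full X (tope⇒full tT))

  negV-tope : ∀ {T} → IsTope L T → IsTope L (negV T)
  negV-tope {T} tT = full⇒tope (L1 T (proj₁ tT)) (negV-full T (tope⇒full tT))

  tope-with-sign : ∀ e {s} → s ≢ zer → Σ (SV n) λ T → IsTope L T × lookup T e ≡ s
  tope-with-sign e s≢0 with loopless e
  ... | T , tT , Te≢0 with ≢zer⇒≡⊎≡neg Te≢0 s≢0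
  ...   | inj₁ Te≡s  = T , tT , Te≡s
  ...   | inj₂ Te≡-s = negV T , negV-tope tT , trans (lookup-negV T e) (sym (≡neg-sym Te≡-s))

  record Eliminant (X Y : SV n) (e : Fin n) : Set where
    field
      Z            : SV n
      covector     : L Z
      vanishes     : lookup Z e ≡ zer
      on-agreement : ∀ {f} → lookup X f ≡ lookup Y f → lookup Z f ≡ lookup X f
      on-zeroˡ     : ∀ {f} → lookup X f ≡ zer → lookup Z f ≡ lookup Y f
      on-zeroʳ     : ∀ {f} → lookup Y f ≡ zer → lookup Z f ≡ lookup X f

  eliminate : ∀ {X Y e} → L X → L Y → Sep X Y e → Eliminant X Y e
  eliminate {X} {Y} {e} LX LY sep with L3 X Y e LX LY sep
  ... | Z , LZ , Ze≡0 , outside = record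
    { Z            = Z
    ; covector     = LZ
    ; vanishes     = Ze≡0
    ; on-agreement = λ {f} Xf≡Yf → trans (outside f (≡⇒¬Sep X Y Xf≡Yf)) (compS-agree Xf≡Yf)
    ; on-zeroˡ     = λ {f} Xf≡0 → trans (outside f (zer⇒¬Sep X Y Xf≡0)) (∘ᵛ-zerˡ X Y Xf≡0)
    ; on-zeroʳ     = λ {f} Yf≡0 → trans (outside f (zerʳ⇒¬Sep Yf≡0)) (compS-zerʳ Yf≡0)
    }
    where
    compS-agree : ∀ {f} → lookup X f ≡ lookup Y f → lookup (X ∘ᵛ Y) f ≡ lookup X f
    compS-agree {f} Xf≡Yf with lookup X f ≟ˢ zer
    ... | yes Xf≡0 = trans (∘ᵛ-zerˡ X Y Xf≡0) (sym Xf≡Yf)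
    ... | no Xf≢0  = ∘ᵛ-≢zerˡ X Y Xf≢0
    zerʳ⇒¬Sep : ∀ {f} → lookup Y f ≡ zer → ¬ Sep X Y f
    zerʳ⇒¬Sep Yf≡0 (Xf≡-Yf , Xf≢0) = Xf≢0 (trans Xf≡-Yf (cong neg Yf≡0))
    compS-zerʳ : ∀ {f} → lookup Y f ≡ zer → lookup (X ∘ᵛ Y) f ≡ lookup X f
    compS-zerʳ {f} Yf≡0 with lookup X f ≟ˢ zer
    ... | yes Xf≡0 = trans (∘ᵛ-zerˡ X Y Xf≡0) (trans Yf≡0 (sym Xf≡0))
    ... | no Xf≢0  = ∘ᵛ-≢zerˡ X Y Xf≢0

  Adjacent : SV n → Fin n → Set
  Adjacent T e = IsTope L T × IsTope L (flipAt e T)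

  adjacent⇒zeroAt : ∀ {T e} → Adjacent T e → L (zeroAt e T)
  adjacent⇒zeroAt {T} {e} (tT , tF) = subst L (lookup-ext agree) covector
    where
    open Eliminant (eliminate (proj₁ tT) (proj₁ tF) (Sep-flipAt T (tope⇒full tT e)))
    agree : ∀ f → lookup Z f ≡ lookup (zeroAt e T) f
    agree f with f ≟ e
    ... | yes refl = trans vanishes (sym (lookup-zeroAt e T))
    ... | no f≢e   = trans (on-agreement (sym (lookup-flipAt-≢ T f≢e))) (sym (lookup-zeroAt-≢ T f≢e))

  zeroAt⇒tope : ∀ {X e} → Full X → L (zeroAt e X) → IsTope L X
  zeroAt⇒tope {X} {e} fullX LZ with tope-with-sign e (fullX e)
  ... | T , tT , Te≡Xe = full⇒tope (subst L (lookup-ext agree) (L2 _ T LZ (proj₁ tT))) fullX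
    where
    agree : ∀ f → lookup (zeroAt e X ∘ᵛ T) f ≡ lookup X f
    agree f with f ≟ e
    ... | yes refl = trans (∘ᵛ-zerˡ (zeroAt e X) T (lookup-zeroAt e X)) Te≡Xe
    ... | no f≢e   = trans (∘ᵛ-≢zerˡ (zeroAt e X) T (fullX f ∘ trans (sym (lookup-zeroAt-≢ X f≢e))))
                           (lookup-zeroAt-≢ X f≢e)

  zeroAt⇒adjacent : ∀ {X e} → Full X → L (zeroAt e X) → Adjacent X e
  zeroAt⇒adjacent {X} {e} fullX LZ =
    zeroAt⇒tope fullX LZ ,
    zeroAt⇒tope (flipAt-full e X fullX) (subst L (sym (zeroAt-flipAt e X)) LZ)

  adjacent-flipAt : ∀ {X e} → Adjacent X e → Adjacent (flipAt e X) e
  adjacent-flipAt {X} {e} (tX , tF) = tF , subst (IsTope L) (sym (flipAt-involutive e X)) tX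

  adjacent-negV : ∀ {X e} → Adjacent X e → Adjacent (negV X) e
  adjacent-negV {X} {e} (tX , tF) = negV-tope tX , subst (IsTope L) (negV-flipAt e X) (negV-tope tF)

  adjacent-flipAt⇔ : ∀ {X e} → Adjacent (flipAt e X) e ⇔ Adjacent X e
  adjacent-flipAt⇔ {X} {e} = mk⇔ (subst (λ V → Adjacent V e) (flipAt-involutive e X) ∘ adjacent-flipAt) adjacent-flipAt

  adjacent-negV⁻ : ∀ {X e} → Adjacent (negV X) e → Adjacent X e
  adjacent-negV⁻ {X} {e} = subst (λ V → Adjacent V e) (negV-involutive X) ∘ adjacent-negV

  flipAt-sepSingleton : ∀ {X : SV n} → Full X → ∀ e → SepIsSingleton X (flipAt e X) e
  flipAt-sepSingleton {X} fullX e f = only-e , at-e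
    where
    only-e : Sep X (flipAt e X) f → f ≡ e
    only-e sep with f ≟ e
    ... | yes f≡e = f≡e
    ... | no f≢e  = contradiction sep (≡⇒¬Sep X (flipAt e X) (sym (lookup-flipAt-≢ X f≢e)))
    at-e : f ≡ e → Sep X (flipAt e X) f
    at-e refl = Sep-flipAt X (fullX e)

  sepSingleton⇒≡flipAt : ∀ {X T : SV n} {e} → Full X → Full T → SepIsSingleton X T e → T ≡ flipAt e X
  sepSingleton⇒≡flipAt {X} {T} {e} fullX fullT singleton = lookup-ext agree
    where
    agree : ∀ f → lookup T f ≡ lookup (flipAt e X) f
    agree f with f ≟ e
    ... | yes refl = trans (≡neg-sym (proj₁ (proj₂ (singleton f) refl))) (sym (lookup-flipAt e X))
    ... | no f≢e   = trans (sym (¬Sep⇒≡ X T fullX fullT (f≢e ∘ proj₁ (singleton f))))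
                           (sym (lookup-flipAt-≢ X f≢e))

-- Rank two

module RankTwo {n} {L : SV n → Set} (om : IsOM L) (rank2 : Rank2 L) (simple : Simple L) where
  open IsOM om
  open Covectors om (proj₁ simple) public

  element : Fin n
  element with proj₁ rank2
  ... | _ , _ , _ , _ , (_ , 0≢X) , _ = proj₁ (≢zeroV⇒∃-≢zer (0≢X ∘ sym))

  above-nonzero⇒tope : ∀ {Y Z} → L Y → Y ≢ zeroV → L Z → ConfStrict Y Z → IsTope L Z
  above-nonzero⇒tope {Y} {Z} LY Y≢0 LZ Y<Z with full⊎∃zer Z
  ... | inj₁ fullZ       = full⇒tope LZ fullZ
  ... | inj₂ (g , Zg≡0) with proj₁ simple g
  -- 0 < Y < Z < Z ∘ T would be a chain of length three.
  ...   | T , (LT , _) , Tg≢0 = ⊥-elim (proj₂ rank2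
    (Y , Z , Z ∘ᵛ T , LY , LZ , L2 Z T LZ LT ,
     ((λ e → inj₁ (lookup-zeroV e)) , Y≢0 ∘ sym) , Y<Z , (conf-∘ᵛ Z T , Z≢Z∘T)))
    where
    Z≢Z∘T : Z ≢ Z ∘ᵛ T
    Z≢Z∘T Z≡Z∘T = Tg≢0 (begin
      lookup T g         ≡⟨ ∘ᵛ-zerˡ Z T Zg≡0 ⟨
      lookup (Z ∘ᵛ T) g  ≡⟨ cong (λ V → lookup V g) Z≡Z∘T ⟨
      lookup Z g         ≡⟨ Zg≡0 ⟩
      zer                ∎)
      where open ≡-Reasoning

  topes-above-unmixed : ∀ {Y T₁ T₂ a b} → L Y → Y ≢ zeroV → IsTope L T₁ → IsTope L T₂ →
    Conf Y T₁ → Conf Y T₂ → lookup Y a ≡ zer → lookup Y b ≡ zer →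
    lookup T₂ a ≡ lookup T₁ a → lookup T₂ b ≡ neg (lookup T₁ b) → ⊥
  topes-above-unmixed {Y} {T₁} {T₂} {a} {b} LY Y≢0 tT₁ tT₂ Y≤T₁ Y≤T₂ Ya≡0 Yb≡0 agree-a oppose-b =
    tope⇒full (above-nonzero⇒tope LY Y≢0 covector (Y≤Z , Y≢Z)) b vanishes
    where
    open Eliminant (eliminate (proj₁ tT₁) (proj₁ tT₂) (≡neg-sym oppose-b , tope⇒full tT₁ b))
    Y≤Z : Conf Y Z
    Y≤Z x with lookup Y x ≟ˢ zer
    ... | yes Yx≡0 = inj₁ Yx≡0
    ... | no Yx≢0  = inj₂ (sym (trans
      (on-agreement (trans (conf-lookup Y T₁ Y≤T₁ Yx≢0) (sym (conf-lookup Y T₂ Y≤T₂ Yx≢0))))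
      (conf-lookup Y T₁ Y≤T₁ Yx≢0)))
    Y≢Z : Y ≢ Z
    Y≢Z Y≡Z = tope⇒full tT₁ a
      (trans (sym (on-agreement (sym agree-a))) (trans (cong (λ V → lookup V a) (sym Y≡Z)) Ya≡0))

  topes-above-aligned : ∀ {Y T₁ T₂ a b} → L Y → Y ≢ zeroV → IsTope L T₁ → IsTope L T₂ →
    Conf Y T₁ → Conf Y T₂ → lookup Y a ≡ zer → lookup Y b ≡ zer →
    (lookup T₂ a ≡ lookup T₁ a × lookup T₂ b ≡ lookup T₁ b) ⊎
    (lookup T₂ a ≡ neg (lookup T₁ a) × lookup T₂ b ≡ neg (lookup T₁ b))
  topes-above-aligned LY Y≢0 tT₁ tT₂ Y≤T₁ Y≤T₂ Ya≡0 Yb≡0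
    with ≢zer⇒≡⊎≡neg (tope⇒full tT₂ _) (tope⇒full tT₁ _) | ≢zer⇒≡⊎≡neg (tope⇒full tT₂ _) (tope⇒full tT₁ _)
  ... | inj₁ agree-a  | inj₁ agree-b  = inj₁ (agree-a , agree-b)
  ... | inj₂ oppose-a | inj₂ oppose-b = inj₂ (oppose-a , oppose-b)
  ... | inj₁ agree-a  | inj₂ oppose-b =
    ⊥-elim (topes-above-unmixed LY Y≢0 tT₁ tT₂ Y≤T₁ Y≤T₂ Ya≡0 Yb≡0 agree-a oppose-b)
  ... | inj₂ oppose-a | inj₁ agree-b  =
    ⊥-elim (topes-above-unmixed LY Y≢0 tT₁ tT₂ Y≤T₁ Y≤T₂ Yb≡0 Ya≡0 agree-b oppose-a)

  tope-above : ∀ {W} e → L W → Σ (SV n) λ T → IsTope L T × Conf W T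
  tope-above {W} e LW with proj₁ simple e
  ... | T , tT , _ = W ∘ᵛ T , ∘ᵛ-tope LW tT , conf-∘ᵛ W T

  -- With σ = id or σ = neg this makes two zeros of a nonzero covector parallel or antiparallel.
  zeros-coupled : ∀ {W e f} → L W → W ≢ zeroV → lookup W e ≡ zer → lookup W f ≡ zer →
    (σ : Sign → Sign) → σ zer ≡ zer → (∀ s → σ (neg s) ≡ neg (σ s)) →
    ∀ {T} → IsTope L T → Conf W T → lookup T e ≡ σ (lookup T f) →
    ∀ X → L X → lookup X e ≡ σ (lookup X f)
  zeros-coupled {W} {e} {f} LW W≢0 We≡0 Wf≡0 σ σ-zer σ-neg {T} tT W≤T Te≡σTf X LX with W ≟ᵛ (W ∘ᵛ X)
  ... | yes W≡W∘X = begin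
    lookup X e         ≡⟨ vanishes-with-W We≡0 ⟩
    zer                ≡⟨ σ-zer ⟨
    σ zer              ≡⟨ cong σ (vanishes-with-W Wf≡0) ⟨
    σ (lookup X f)     ∎
    where
    open ≡-Reasoning
    vanishes-with-W : ∀ {g} → lookup W g ≡ zer → lookup X g ≡ zer
    vanishes-with-W {g} Wg≡0 =
      trans (sym (∘ᵛ-zerˡ W X Wg≡0)) (trans (cong (λ V → lookup V g) (sym W≡W∘X)) Wg≡0)
  ... | no W≢W∘X with topes-above-aligned LW W≢0 tT
                        (above-nonzero⇒tope LW W≢0 (L2 W X LW LX) (conf-∘ᵛ W X , W≢W∘X))
                        W≤T (conf-∘ᵛ W X) We≡0 Wf≡0
  ...   | inj₁ (agree-e , agree-f) = begin
    lookup X e                ≡⟨ ∘ᵛ-zerˡ W X We≡0 ⟨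
    lookup (W ∘ᵛ X) e         ≡⟨ agree-e ⟩
    lookup T e                ≡⟨ Te≡σTf ⟩
    σ (lookup T f)            ≡⟨ cong σ agree-f ⟨
    σ (lookup (W ∘ᵛ X) f)     ≡⟨ cong σ (∘ᵛ-zerˡ W X Wf≡0) ⟩
    σ (lookup X f)            ∎
    where open ≡-Reasoning
  ...   | inj₂ (oppose-e , oppose-f) = begin
    lookup X e                ≡⟨ ∘ᵛ-zerˡ W X We≡0 ⟨
    lookup (W ∘ᵛ X) e         ≡⟨ oppose-e ⟩
    neg (lookup T e)          ≡⟨ cong neg Te≡σTf ⟩
    neg (σ (lookup T f))      ≡⟨ σ-neg _ ⟨
    σ (neg (lookup T f))      ≡⟨ cong σ oppose-f ⟨
    σ (lookup (W ∘ᵛ X) f)     ≡⟨ cong σ (∘ᵛ-zerˡ W X Wf≡0) ⟩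
    σ (lookup X f)            ∎
    where open ≡-Reasoning

  zer-unique : ∀ {W e f} → L W → W ≢ zeroV → lookup W e ≡ zer → lookup W f ≡ zer → e ≡ f
  zer-unique {W} {e} {f} LW W≢0 We≡0 Wf≡0 with e ≟ f | tope-above e LW
  ... | yes e≡f | _ = e≡f
  ... | no e≢f  | T , tT , W≤T with ≢zer⇒≡⊎≡neg (tope⇒full tT e) (tope⇒full tT f)
  ...   | inj₁ Te≡Tf  = contradiction
    (zeros-coupled LW W≢0 We≡0 Wf≡0 id refl (λ _ → refl) tT W≤T Te≡Tf)
    (proj₁ (proj₂ simple) e f e≢f)
  ...   | inj₂ Te≡-Tf = contradiction
    (zeros-coupled LW W≢0 We≡0 Wf≡0 neg refl (λ _ → refl) tT W≤T Te≡-Tf)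
    (proj₂ (proj₂ simple) e f e≢f)

  CocircuitAt : Fin n → SV n → Set
  CocircuitAt e Y = L Y × Y ≢ zeroV × lookup Y e ≡ zer

  cocircuit-≢zer : ∀ {e Y} → CocircuitAt e Y → ∀ {f} → f ≢ e → lookup Y f ≢ zer
  cocircuit-≢zer (LY , Y≢0 , Ye≡0) f≢e Yf≡0 = f≢e (zer-unique LY Y≢0 Yf≡0 Ye≡0)

  cocircuit-through : ∀ {X e g} → L X → lookup X e ≢ zer → lookup X g ≡ zer → Σ (SV n) (CocircuitAt e)
  cocircuit-through {X} {e} {g} LX Xe≢0 Xg≡0 with proj₁ simple g
  ... | T , (LT , _) , Tg≢0 = Z , covector , ≢zer⇒≢zeroV Zg≢0 , vanishes
    where
    -Xe≢0 : lookup (negV X) e ≢ zer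
    -Xe≢0 = neg-≢zer Xe≢0 ∘ trans (sym (lookup-negV X e))
    -Xg≡0 : lookup (negV X) g ≡ zer
    -Xg≡0 = trans (lookup-negV X g) (cong neg Xg≡0)
    separated : Sep (X ∘ᵛ T) (negV X ∘ᵛ T) e
    separated =
      trans (∘ᵛ-≢zerˡ X T Xe≢0) (≡neg-sym (trans (∘ᵛ-≢zerˡ (negV X) T -Xe≢0) (lookup-negV X e))) ,
      Xe≢0 ∘ trans (sym (∘ᵛ-≢zerˡ X T Xe≢0))
    open Eliminant (eliminate (L2 X T LX LT) (L2 (negV X) T (L1 X LX) LT) separated)
    Zg≢0 : lookup Z g ≢ zer
    Zg≢0 = Tg≢0 ∘ trans (sym (trans
      (on-agreement (trans (∘ᵛ-zerˡ X T Xg≡0) (sym (∘ᵛ-zerˡ (negV X) T -Xg≡0))))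
      (∘ᵛ-zerˡ X T Xg≡0)))

  cocircuitAt : ∀ e → Σ (SV n) (CocircuitAt e)
  cocircuitAt e with proj₁ rank2
  ... | X , _ , LX , _ , (_ , 0≢X) , (X≤X₂ , X≢X₂) with lookup X e ≟ˢ zer | full⊎∃zer X
  ...   | yes Xe≡0 | _               = X , LX , 0≢X ∘ sym , Xe≡0
  ...   | no _     | inj₁ fullX      = contradiction (conf-full⇒≡ X _ X≤X₂ fullX) X≢X₂
  ...   | no Xe≢0  | inj₂ (g , Xg≡0) = cocircuit-through LX Xe≢0 Xg≡0

  other-element : ∀ e → ∃ λ f → f ≢ e
  other-element e with cocircuitAt e
  ... | Y , _ , Y≢0 , Ye≡0 with ≢zeroV⇒∃-≢zer Y≢0
  ...   | f , Yf≢0 = f , λ { refl → Yf≢0 Ye≡0 }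

  cocircuit-unique : ∀ {e Y Y′} → CocircuitAt e Y → CocircuitAt e Y′ → Y′ ≡ Y ⊎ Y′ ≡ negV Y
  cocircuit-unique {e} {Y} {Y′} cY cY′ with Y′ ≟ᵛ Y | Y′ ≟ᵛ negV Y
  ... | yes Y′≡Y | _         = inj₁ Y′≡Y
  ... | no _     | yes Y′≡-Y = inj₂ Y′≡-Y
  ... | no Y′≢Y  | no Y′≢-Y  with ≢⇒∃-lookup-≢ Y′≢Y | ≢⇒∃-lookup-≢ Y′≢-Y
  ...   | g , Y′g≢Yg | h , Y′h≢-Yh = ⊥-elim (g≢e (zer-unique covector Z≢0 vanishes Ze≡0))
    where
    Ye≡0 : lookup Y e ≡ zer
    Ye≡0 = proj₂ (proj₂ cY)
    Y′e≡0 : lookup Y′ e ≡ zer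
    Y′e≡0 = proj₂ (proj₂ cY′)
    g≢e : g ≢ e
    g≢e refl = Y′g≢Yg (trans Y′e≡0 (sym Ye≡0))
    h≢e : h ≢ e
    h≢e refl = Y′h≢-Yh (trans Y′e≡0 (sym (trans (lookup-negV Y e) (cong neg Ye≡0))))
    Y′g≡-Yg : lookup Y′ g ≡ neg (lookup Y g)
    Y′g≡-Yg with ≢zer⇒≡⊎≡neg (cocircuit-≢zer cY′ g≢e) (cocircuit-≢zer cY g≢e)
    ... | inj₁ Y′g≡Yg  = contradiction Y′g≡Yg Y′g≢Yg
    ... | inj₂ Y′g≡-Yg = Y′g≡-Yg
    Y′h≡Yh : lookup Y′ h ≡ lookup Y h
    Y′h≡Yh with ≢zer⇒≡⊎≡neg (cocircuit-≢zer cY′ h≢e) (cocircuit-≢zer cY h≢e)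
    ... | inj₁ Y′h≡Yh  = Y′h≡Yh
    ... | inj₂ Y′h≡-Yh = contradiction (trans Y′h≡-Yh (sym (lookup-negV Y h))) Y′h≢-Yh
    open Eliminant (eliminate (proj₁ cY) (proj₁ cY′) (≡neg-sym Y′g≡-Yg , cocircuit-≢zer cY g≢e))
    Ze≡0 : lookup Z e ≡ zer
    Ze≡0 = trans (on-agreement (trans Ye≡0 (sym Y′e≡0))) Ye≡0
    Z≢0 : Z ≢ zeroV
    Z≢0 = ≢zer⇒≢zeroV (cocircuit-≢zer cY h≢e ∘ trans (sym (on-agreement (sym Y′h≡Yh))))

  zeroAt-cocircuit : ∀ {X e} → Adjacent X e → CocircuitAt e (zeroAt e X)
  zeroAt-cocircuit {X} {e} adj with other-element e
  ... | f , f≢e = adjacent⇒zeroAt adj ,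
                  ≢zer⇒≢zeroV (tope⇒full (proj₁ adj) f ∘ trans (sym (lookup-zeroAt-≢ X f≢e))) ,
                  lookup-zeroAt e X

  no-three-neighbours : ∀ {T a b c} → Adjacent T a → Adjacent T b → Adjacent T c →
                        a ≢ b → c ≢ a → c ≢ b → ⊥
  no-three-neighbours {T} {a} {b} {c} adj-a adj-b adj-c a≢b c≢a c≢b =
    [ Z≢Zc , Z≢-Zc ]′ (cocircuit-unique (zeroAt-cocircuit adj-c) (covector , Z≢0 , vanishes))
    where
    fullT : Full T
    fullT = tope⇒full (proj₁ adj-a)
    -Zbc≡-Tc : lookup (negV (zeroAt b T)) c ≡ neg (lookup T c)
    -Zbc≡-Tc = trans (lookup-negV (zeroAt b T) c) (cong neg (lookup-zeroAt-≢ T c≢b))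
    separated : Sep (zeroAt a T) (negV (zeroAt b T)) c
    separated = trans (lookup-zeroAt-≢ T c≢a) (≡neg-sym -Zbc≡-Tc) , fullT c ∘ trans (sym (lookup-zeroAt-≢ T c≢a))
    open Eliminant (eliminate (adjacent⇒zeroAt adj-a) (L1 _ (adjacent⇒zeroAt adj-b)) separated)
    Za≡-Ta : lookup Z a ≡ neg (lookup T a)
    Za≡-Ta = trans (on-zeroˡ (lookup-zeroAt a T))
                   (trans (lookup-negV (zeroAt b T) a) (cong neg (lookup-zeroAt-≢ T a≢b)))
    Zb≡Tb : lookup Z b ≡ lookup T b
    Zb≡Tb = trans (on-zeroʳ (trans (lookup-negV (zeroAt b T) b) (cong neg (lookup-zeroAt b T))))
                  (lookup-zeroAt-≢ T (a≢b ∘ sym))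
    Z≢0 : Z ≢ zeroV
    Z≢0 = ≢zer⇒≢zeroV (fullT b ∘ trans (sym Zb≡Tb))
    Z≢Zc : Z ≢ zeroAt c T
    Z≢Zc Z≡Zc = fullT a (≡neg⇒≡zer (begin
      lookup T a              ≡⟨ lookup-zeroAt-≢ T (c≢a ∘ sym) ⟨
      lookup (zeroAt c T) a   ≡⟨ cong (λ V → lookup V a) Z≡Zc ⟨
      lookup Z a              ≡⟨ Za≡-Ta ⟩
      neg (lookup T a)        ∎))
      where open ≡-Reasoning
    Z≢-Zc : Z ≢ negV (zeroAt c T)
    Z≢-Zc Z≡-Zc = fullT b (≡neg⇒≡zer (begin
      lookup T b                      ≡⟨ Zb≡Tb ⟨
      lookup Z b                      ≡⟨ cong (λ V → lookup V b) Z≡-Zc ⟩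
      lookup (negV (zeroAt c T)) b    ≡⟨ lookup-negV (zeroAt c T) b ⟩
      neg (lookup (zeroAt c T) b)     ≡⟨ cong neg (lookup-zeroAt-≢ T (c≢b ∘ sym)) ⟩
      neg (lookup T b)                ∎))
      where open ≡-Reasoning

  adjacent-≤2 : ∀ {T a b c} → Adjacent T a → Adjacent T b → a ≢ b → Adjacent T c → c ≡ a ⊎ c ≡ b
  adjacent-≤2 {T} {a} {b} {c} adj-a adj-b a≢b adj-c with c ≟ a | c ≟ b
  ... | yes c≡a | _       = inj₁ c≡a
  ... | no _    | yes c≡b = inj₂ c≡b
  ... | no c≢a  | no c≢b  = ⊥-elim (no-three-neighbours adj-a adj-b adj-c a≢b c≢a c≢b)

  flipAt≡cocircuit-∘ᵛ-negV : ∀ {e Y K} → CocircuitAt e Y → Full K → Y ∘ᵛ K ≡ K → flipAt e K ≡ Y ∘ᵛ negV K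
  flipAt≡cocircuit-∘ᵛ-negV {e} {Y} {K} cY fullK Y∘K≡K = lookup-ext agree
    where
    agree : ∀ f → lookup (flipAt e K) f ≡ lookup (Y ∘ᵛ negV K) f
    agree f with f ≟ e
    ... | yes refl = begin
      lookup (flipAt f K) f     ≡⟨ lookup-flipAt f K ⟩
      neg (lookup K f)          ≡⟨ lookup-negV K f ⟨
      lookup (negV K) f         ≡⟨ ∘ᵛ-zerˡ Y (negV K) (proj₂ (proj₂ cY)) ⟨
      lookup (Y ∘ᵛ negV K) f    ∎
      where open ≡-Reasoning
    ... | no f≢e = begin
      lookup (flipAt e K) f     ≡⟨ lookup-flipAt-≢ K f≢e ⟩
      lookup K f                ≡⟨ cong (λ V → lookup V f) Y∘K≡K ⟨
      lookup (Y ∘ᵛ K) f         ≡⟨ ∘ᵛ-≢zerˡ Y K (cocircuit-≢zer cY f≢e) ⟩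
      lookup Y f                ≡⟨ ∘ᵛ-≢zerˡ Y (negV K) (cocircuit-≢zer cY f≢e) ⟨
      lookup (Y ∘ᵛ negV K) f    ∎
      where open ≡-Reasoning

  separating-cocircuit : ∀ {K R e} → IsTope L K → IsTope L R → Sep K R e →
    Σ (SV n) λ Y → CocircuitAt e Y × (∀ f → Sep K (Y ∘ᵛ K) f → Sep K R f)
  separating-cocircuit {K} {R} {e} tK tR sep = choose (Z ≟ᵛ zeroV)
    where
    open Eliminant (eliminate (proj₁ tK) (proj₁ tR) sep)
    fullK : Full K
    fullK = tope⇒full tK
    Z-outside : ∀ {f} → ¬ Sep K R f → lookup Z f ≡ lookup K f
    Z-outside ¬sep = on-agreement (¬Sep⇒≡ K R fullK (tope⇒full tR) ¬sep)
    -- If the eliminant vanishes, K and R are separated everywhere and any cocircuit at e will do.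
    choose : Dec (Z ≡ zeroV) → Σ (SV n) λ Y → CocircuitAt e Y × (∀ f → Sep K (Y ∘ᵛ K) f → Sep K R f)
    choose (yes Z≡0) = proj₁ (cocircuitAt e) , proj₂ (cocircuitAt e) , λ f _ → all-separated f
      where
      all-separated : ∀ f → Sep K R f
      all-separated f with Sep? K R f
      ... | yes sep′ = sep′
      ... | no ¬sep  = contradiction
        (trans (sym (Z-outside ¬sep)) (trans (cong (λ V → lookup V f) Z≡0) (lookup-zeroV f))) (fullK f)
    choose (no Z≢0) = Z , (covector , Z≢0 , vanishes) , narrower
      where
      narrower : ∀ f → Sep K (Z ∘ᵛ K) f → Sep K R f
      narrower f sep′ with Sep? K R f
      ... | yes sep″ = sep″
      ... | no ¬sep  = contradiction sep′ (≡⇒¬Sep K (Z ∘ᵛ K) (sym (trans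
        (∘ᵛ-≢zerˡ Z K (fullK f ∘ trans (sym (Z-outside ¬sep)))) (Z-outside ¬sep))))

  topes-separated : ∀ {K R} → IsTope L K → IsTope L R → K ≢ R → ∃ λ e → Sep K R e
  topes-separated {K} {R} tK tR K≢R with ≢⇒∃-lookup-≢ K≢R
  ... | e , Ke≢Re = e , full⇒Sep K R (tope⇒full tK) (tope⇒full tR) Ke≢Re

  neighbour-or-closer : ∀ {K R e} → IsTope L K → IsTope L R → Sep K R e →
    Adjacent K e ⊎ Σ (SV n) λ R′ → IsTope L R′ × (∃ λ f → Sep K R′ f) ×
                                   (∀ f → Sep K R′ f → Sep K R f) × ¬ Sep K R′ e
  neighbour-or-closer {K} {R} {e} tK tR sep with separating-cocircuit tK tR sep
  ... | Y , cY , narrower with (Y ∘ᵛ K) ≟ᵛ K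
  ...   | yes Y∘K≡K = inj₁ (tK , subst (IsTope L) (sym (flipAt≡cocircuit-∘ᵛ-negV cY (tope⇒full tK) Y∘K≡K))
                                     (∘ᵛ-tope (proj₁ cY) (negV-tope tK)))
  ...   | no Y∘K≢K = inj₂ (Y ∘ᵛ K , tR′ , topes-separated tK tR′ (Y∘K≢K ∘ sym) , narrower ,
                           ≡⇒¬Sep K (Y ∘ᵛ K) (sym (∘ᵛ-zerˡ Y K (proj₂ (proj₂ cY)))))
    where
    tR′ : IsTope L (Y ∘ᵛ K)
    tR′ = ∘ᵛ-tope (proj₁ cY) tK

  neighbour-towards : ∀ {K R} → IsTope L K → IsTope L R → K ≢ R → ∃ λ e → Sep K R e × Adjacent K e
  neighbour-towards {K} {R} tK tR K≢R with topes-separated tK tR K≢R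
  ... | e , sep = towards tR sep (<-wellFounded (sepCount K R))
    where
    towards : ∀ {R e} → IsTope L R → Sep K R e → Acc _<_ (sepCount K R) → ∃ λ f → Sep K R f × Adjacent K f
    towards {R} {e} tR sep (acc smaller) with neighbour-or-closer tK tR sep
    ... | inj₁ adj = e , sep , adj
    ... | inj₂ (R′ , tR′ , (e′ , sep′) , narrower , ¬sep′) with
          towards tR′ sep′ (smaller (sepCount-< K R R′ narrower sep ¬sep′))
    ...   | f , sep″ , adj = f , narrower f sep″ , adj

  another-neighbour : ∀ {T e₁} → Adjacent T e₁ → ∃ λ e₂ → e₁ ≢ e₂ × Adjacent T e₂
  another-neighbour {T} {e₁} adj₁ = e₂ , e₁≢e₂ , adj₂
    where
    R : SV n
    R = negV (flipAt e₁ T)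
    x : Fin n
    x = proj₁ (other-element e₁)
    Rx≡-Tx : lookup R x ≡ neg (lookup T x)
    Rx≡-Tx = trans (lookup-negV (flipAt e₁ T) x) (cong neg (lookup-flipAt-≢ T (proj₂ (other-element e₁))))
    towards-R : ∃ λ e₂ → Sep T R e₂ × Adjacent T e₂
    towards-R = neighbour-towards (proj₁ adj₁) (negV-tope (proj₂ adj₁)) (≡neg-at⇒≢ (tope⇒full (proj₁ adj₁) x) Rx≡-Tx)
    e₂ : Fin n
    e₂ = proj₁ towards-R
    adj₂ : Adjacent T e₂
    adj₂ = proj₂ (proj₂ towards-R)
    Re₁≡Te₁ : lookup R e₁ ≡ lookup T e₁
    Re₁≡Te₁ = begin
      lookup (negV (flipAt e₁ T)) e₁   ≡⟨ lookup-negV (flipAt e₁ T) e₁ ⟩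
      neg (lookup (flipAt e₁ T) e₁)    ≡⟨ cong neg (lookup-flipAt e₁ T) ⟩
      neg (neg (lookup T e₁))          ≡⟨ neg-involutive _ ⟩
      lookup T e₁                      ∎
      where open ≡-Reasoning
    e₁≢e₂ : e₁ ≢ e₂
    e₁≢e₂ e₁≡e₂ = ≡⇒¬Sep T R (sym Re₁≡Te₁) (subst (Sep T R) (sym e₁≡e₂) (proj₁ (proj₂ towards-R)))

  tope≢negV : ∀ {T} → IsTope L T → T ≢ negV T
  tope≢negV {T} tT = ≡neg-at⇒≢ (tope⇒full tT element) (lookup-negV T element)

  two-neighbours : ∀ {T} → IsTope L T → ∃₂ λ e₁ e₂ → e₁ ≢ e₂ × Adjacent T e₁ × Adjacent T e₂
  two-neighbours tT =
    let e₁ , _ , adj₁ = neighbour-towards tT (negV-tope tT) (tope≢negV tT)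
        e₂ , e₁≢e₂ , adj₂ = another-neighbour adj₁
    in  e₁ , e₂ , e₁≢e₂ , adj₁ , adj₂

  -- A full X is adjacent at e iff zeroAt e X is a covector, i.e. plus or minus the cocircuit at e.
  adjacent? : ∀ X e → Dec (Adjacent X e)
  adjacent? X e with full⊎∃zer X
  ... | inj₂ (g , Xg≡0) = no λ adj → tope⇒full (proj₁ adj) g Xg≡0
  ... | inj₁ fullX with cocircuitAt e
  ...   | Y , cY with zeroAt e X ≟ᵛ Y | zeroAt e X ≟ᵛ negV Y
  ...     | yes Z≡Y | _        = yes (zeroAt⇒adjacent fullX (subst L (sym Z≡Y) (proj₁ cY)))
  ...     | no _    | yes Z≡-Y = yes (zeroAt⇒adjacent fullX (subst L (sym Z≡-Y) (L1 Y (proj₁ cY))))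
  ...     | no Z≢Y  | no Z≢-Y  = no λ adj → [ Z≢Y , Z≢-Y ]′ (cocircuit-unique cY (zeroAt-cocircuit adj))

  adjacent-with-sign : ∀ e {s} → s ≢ zer → Σ (SV n) λ X → Adjacent X e × lookup X e ≡ s
  adjacent-with-sign e s≢0 with cocircuitAt e | tope-with-sign e s≢0
  ... | Y , cY | T , tT , Te≡s =
    Y ∘ᵛ T ,
    zeroAt⇒adjacent (∘ᵛ-full Y (tope⇒full tT)) (subst L (sym zeroAt≡Y) (proj₁ cY)) ,
    trans (∘ᵛ-zerˡ Y T (proj₂ (proj₂ cY))) Te≡s
    where
    zeroAt≡Y : zeroAt e (Y ∘ᵛ T) ≡ Y
    zeroAt≡Y = lookup-ext agree
      where
      agree : ∀ f → lookup (zeroAt e (Y ∘ᵛ T)) f ≡ lookup Y f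
      agree f with f ≟ e
      ... | yes refl = trans (lookup-zeroAt f (Y ∘ᵛ T)) (sym (proj₂ (proj₂ cY)))
      ... | no f≢e   = trans (lookup-zeroAt-≢ (Y ∘ᵛ T) f≢e) (∘ᵛ-≢zerˡ Y T (cocircuit-≢zer cY f≢e))

-- Peaks

module Peaks {n} {L : SV n → Set} (om : IsOM L) (rank2 : Rank2 L) (simple : Simple L) where
  open RankTwo om rank2 simple

  Peak : SV n → Set
  Peak K = IsTope L K × (∀ e → Adjacent K e → lookup K e ≡ plus)

  inKStar⇔peak : ∀ {K} → InKStar L K ⇔ Peak K
  inKStar⇔peak {K} = mk⇔ to from
    where
    to : InKStar L K → Peak K
    to (tK , positive) = tK , λ e adj →
      positive (flipAt e K) e (proj₂ adj) (flipAt-sepSingleton {X = K} (tope⇒full tK) e)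
    from : Peak K → InKStar L K
    from (tK , positive) = tK , λ T e tT singleton → positive e
      (tK , subst (IsTope L) (sepSingleton⇒≡flipAt {X = K} {T} (tope⇒full tK) (tope⇒full tT) singleton) tT)

  peak⇔maxPlus : ∀ {K} → Peak K ⇔ InMaxPlusTopes L K
  peak⇔maxPlus {K} = mk⇔ to from
    where
    to : Peak K → InMaxPlusTopes L K
    to (tK , positive) = tK , not-below
      where
      not-below : ∀ R → IsTope L R → ¬ PlusStrict K R
      not-below R tR (K⁺⊆R⁺ , e , Re≡+ , Ke≢+) with neighbour-towards tK tR (λ { refl → Ke≢+ Re≡+ })
      ... | f , sep , adj = ≡⇒¬Sep K R (trans Kf≡+ (sym (K⁺⊆R⁺ f Kf≡+))) sep
        where
        Kf≡+ : lookup K f ≡ plus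
        Kf≡+ = positive f adj
    from : InMaxPlusTopes L K → Peak K
    from (tK , maximal) = tK , positive
      where
      positive : ∀ e → Adjacent K e → lookup K e ≡ plus
      positive e adj with lookup K e ≟ˢ plus
      ... | yes Ke≡+ = Ke≡+
      ... | no Ke≢+  = ⊥-elim (maximal (flipAt e K) (proj₂ adj) (K⁺⊆flip⁺ , e , flip-e≡+ , Ke≢+))
        where
        flip-e≡+ : lookup (flipAt e K) e ≡ plus
        flip-e≡+ = trans (lookup-flipAt e K) (cong neg (≢zer∧≢plus⇒≡minus (tope⇒full tK e) Ke≢+))
        K⁺⊆flip⁺ : PlusSub K (flipAt e K)
        K⁺⊆flip⁺ f Kf≡+ with f ≟ e
        ... | yes refl = contradiction Kf≡+ Ke≢+
        ... | no f≢e   = trans (lookup-flipAt-≢ K f≢e) Kf≡+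

  peak⇔plus-at-neighbours : ∀ {K e₁ e₂} → e₁ ≢ e₂ → Adjacent K e₁ → Adjacent K e₂ →
    Peak K ⇔ (lookup K e₁ ≡ plus × lookup K e₂ ≡ plus)
  peak⇔plus-at-neighbours {K} {e₁} {e₂} e₁≢e₂ adj₁ adj₂ = mk⇔
    (λ (_ , positive) → positive e₁ adj₁ , positive e₂ adj₂)
    (λ (Ke₁≡+ , Ke₂≡+) → proj₁ adj₁ , λ f adj →
      [ (λ { refl → Ke₁≡+ }) , (λ { refl → Ke₂≡+ }) ]′ (adjacent-≤2 adj₁ adj₂ e₁≢e₂ adj))

  plus-at-neighbours⇒≡ : ∀ {K X e₁ e₂} → Peak K → e₁ ≢ e₂ → Adjacent K e₁ → Adjacent K e₂ → IsTope L X →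
    lookup X e₁ ≡ plus → lookup X e₂ ≡ plus → X ≡ K
  plus-at-neighbours⇒≡ {K} {X} {e₁} {e₂} (tK , positive) e₁≢e₂ adj₁ adj₂ tX Xe₁≡+ Xe₂≡+ with X ≟ᵛ K
  ... | yes X≡K = X≡K
  ... | no X≢K with neighbour-towards tK tX (X≢K ∘ sym)
  ...   | f , sep , adj = ⊥-elim ([ agree Xe₁≡+ adj₁ , agree Xe₂≡+ adj₂ ]′ (adjacent-≤2 adj₁ adj₂ e₁≢e₂ adj))
    where
    agree : ∀ {e} → lookup X e ≡ plus → Adjacent K e → f ≢ e
    agree Xe≡+ adj-e refl = ≡⇒¬Sep K X (trans (positive f adj-e) (sym Xe≡+)) sep

  committee-contains-peak : ∀ {K} (S : SVSet n) → Peak K → IsCommittee L S → K ∈ˢ S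
  committee-contains-peak {K} S peak (members , majority) = ¬-not (excluded (two-neighbours (proj₁ peak)))
    where
    excluded : (∃₂ λ e₁ e₂ → e₁ ≢ e₂ × Adjacent K e₁ × Adjacent K e₂) → S K ≢ false
    excluded (e₁ , e₂ , e₁≢e₂ , adj₁ , adj₂) K∉S =
      two-majorities⇒⊥ {cardPlus S e₁} {cardPlus S e₂} (cardPlus+cardPlus≤card S e₁ e₂ only-K) (majority e₁) (majority e₂)
      where
      only-K : ∀ X → X ∈ˢ S → lookup X e₁ ≡ plus → lookup X e₂ ≡ plus → ⊥
      only-K X X∈S Xe₁≡+ Xe₂≡+ = contradiction (trans (sym X∈S) (trans (cong S X≡K) K∉S)) λ ()
        where
        X≡K : X ≡ K
        X≡K = plus-at-neighbours⇒≡ peak e₁≢e₂ adj₁ adj₂ (members X X∈S) Xe₁≡+ Xe₂≡+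

  module Counting (S : SVSet n) (S⇔peak : ∀ X → X ∈ˢ S ⇔ Peak X) where

    neighbourCount : (Sign → Bool) → SV n → ℕ
    neighbourCount q X = ∑[ f < n ] 𝟙 (does (adjacent? X f) ∧ q (lookup X f))

    neighbourCount-none : ∀ q {X} → (∀ f → ¬ Adjacent X f) → neighbourCount q X ≡ 0
    neighbourCount-none q {X} none =
      ∑-zero λ f → cong (λ b → 𝟙 (b ∧ q (lookup X f))) (dec-false (adjacent? X f) (none f))

    neighbourCount-two : ∀ q {X e₁ e₂} → e₁ ≢ e₂ → Adjacent X e₁ → Adjacent X e₂ →
      neighbourCount q X ≡ 𝟙 (q (lookup X e₁)) + 𝟙 (q (lookup X e₂))
    neighbourCount-two q {X} {e₁} {e₂} e₁≢e₂ adj₁ adj₂ = begin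
      neighbourCount q X                           ≡⟨ sum-cong-≗ split ⟩
      ∑[ f < n ] (at e₁ f + at e₂ f)               ≡⟨ ∑-distrib-+ (at e₁) (at e₂) ⟩
      ∑[ f < n ] at e₁ f + ∑[ f < n ] at e₂ f      ≡⟨ cong₂ _+_ (∑-delta (at e₁) e₁ (off e₁)) (∑-delta (at e₂) e₂ (off e₂)) ⟩
      at e₁ e₁ + at e₂ e₂                          ≡⟨ cong₂ _+_ (on e₁) (on e₂) ⟩
      𝟙 (q (lookup X e₁)) + 𝟙 (q (lookup X e₂))    ∎
      where
      open ≡-Reasoning
      at : Fin n → Fin n → ℕ
      at e f = 𝟙 (does (f ≟ e) ∧ q (lookup X f))
      off : ∀ e f → f ≢ e → at e f ≡ 0
      off e f f≢e = cong (λ b → 𝟙 (b ∧ q (lookup X f))) (dec-false (f ≟ e) f≢e)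
      on : ∀ e → at e e ≡ 𝟙 (q (lookup X e))
      on e = cong (λ b → 𝟙 (b ∧ q (lookup X e))) (dec-true (e ≟ e) refl)
      split : ∀ f → 𝟙 (does (adjacent? X f) ∧ q (lookup X f)) ≡
                    𝟙 (does (f ≟ e₁) ∧ q (lookup X f)) + 𝟙 (does (f ≟ e₂) ∧ q (lookup X f))
      split f with f ≟ e₁ | f ≟ e₂ | adjacent? X f
      ... | yes refl | yes refl | _       = contradiction refl e₁≢e₂
      ... | yes refl | no _     | yes _   = sym (+-identityʳ _)
      ... | yes refl | no _     | no ¬adj = contradiction adj₁ ¬adj
      ... | no _     | yes refl | yes _   = refl
      ... | no _     | yes refl | no ¬adj = contradiction adj₂ ¬adj
      ... | no f≢e₁  | no f≢e₂  | yes adj = ⊥-elim ([ f≢e₁ , f≢e₂ ]′ (adjacent-≤2 adj₁ adj₂ e₁≢e₂ adj))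
      ... | no _     | no _     | no _    = refl

    isolated⇒∉S : ∀ {X} → (∀ f → ¬ Adjacent X f) → S X ≡ false
    isolated⇒∉S {X} none = ¬-not λ X∈S →
      let e₁ , _ , _ , adj₁ , _ = two-neighbours (proj₁ (Equivalence.to (S⇔peak X) X∈S)) in none e₁ adj₁

    S≡isPlus∧isPlus : ∀ {X e₁ e₂} → e₁ ≢ e₂ → Adjacent X e₁ → Adjacent X e₂ →
            S X ≡ isPlus (lookup X e₁) ∧ isPlus (lookup X e₂)
    S≡isPlus∧isPlus {X} e₁≢e₂ adj₁ adj₂ = ≡true⇔≡true⇒≡
      (⇔.trans (S⇔peak X) (⇔.trans (peak⇔plus-at-neighbours e₁≢e₂ adj₁ adj₂) isPlus∧isPlus⇔))

    LocallyBalanced : SV n → Set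
    LocallyBalanced X = neighbourCount isPlus X + 2 * 𝟙 (S (negV X)) ≡ neighbourCount isMinus X + 2 * 𝟙 (S X)

    isolated-balanced : ∀ {X} → (∀ f → ¬ Adjacent X f) → LocallyBalanced X
    isolated-balanced {X} none = begin
      neighbourCount isPlus X + 2 * 𝟙 (S (negV X))
        ≡⟨ cong₂ (λ c b → c + 2 * 𝟙 b) (neighbourCount-none isPlus none) (isolated⇒∉S (λ f → none f ∘ adjacent-negV⁻)) ⟩
      0
        ≡⟨ cong₂ (λ c b → c + 2 * 𝟙 b) (neighbourCount-none isMinus none) (isolated⇒∉S none) ⟨
      neighbourCount isMinus X + 2 * 𝟙 (S X) ∎
      where open ≡-Reasoning

    tope-balanced : ∀ {X e₁ e₂} → e₁ ≢ e₂ → Adjacent X e₁ → Adjacent X e₂ → LocallyBalanced X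
    tope-balanced {X} {e₁} {e₂} e₁≢e₂ adj₁ adj₂ = begin
      neighbourCount isPlus X + 2 * 𝟙 (S (negV X))
        ≡⟨ cong₂ (λ c b → c + 2 * 𝟙 b) (neighbourCount-two isPlus e₁≢e₂ adj₁ adj₂)
                                       (S≡isPlus∧isPlus e₁≢e₂ (adjacent-negV adj₁) (adjacent-negV adj₂)) ⟩
      𝟙 (isPlus s₁) + 𝟙 (isPlus s₂) + 2 * 𝟙 (isPlus (lookup (negV X) e₁) ∧ isPlus (lookup (negV X) e₂))
        ≡⟨ cong (λ b → 𝟙 (isPlus s₁) + 𝟙 (isPlus s₂) + 2 * 𝟙 b) (cong₂ _∧_ (isPlus-negV e₁) (isPlus-negV e₂)) ⟩
      𝟙 (isPlus s₁) + 𝟙 (isPlus s₂) + 2 * 𝟙 (isMinus s₁ ∧ isMinus s₂)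
        ≡⟨ sign-balance (tope⇒full (proj₁ adj₁) e₁) (tope⇒full (proj₁ adj₁) e₂) ⟩
      𝟙 (isMinus s₁) + 𝟙 (isMinus s₂) + 2 * 𝟙 (isPlus s₁ ∧ isPlus s₂)
        ≡⟨ cong₂ (λ c b → c + 2 * 𝟙 b) (neighbourCount-two isMinus e₁≢e₂ adj₁ adj₂) (S≡isPlus∧isPlus e₁≢e₂ adj₁ adj₂) ⟨
      neighbourCount isMinus X + 2 * 𝟙 (S X) ∎
      where
      open ≡-Reasoning
      s₁ s₂ : Sign
      s₁ = lookup X e₁
      s₂ = lookup X e₂
      isPlus-negV : ∀ e → isPlus (lookup (negV X) e) ≡ isMinus (lookup X e)
      isPlus-negV e = trans (cong isPlus (lookup-negV X e)) (isPlus-neg _)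

    locally-balanced : ∀ X → LocallyBalanced X
    locally-balanced X with any? (adjacent? X)
    ... | no ¬adjacent = isolated-balanced (λ f adj → ¬adjacent (f , adj))
    ... | yes (_ , adj) =
      let _ , _ , e₁≢e₂ , adj₁ , adj₂ = two-neighbours (proj₁ adj) in tope-balanced e₁≢e₂ adj₁ adj₂

    module _ (e : Fin n) where

      positiveAt : SV n → Bool
      positiveAt X = isPlus (lookup X e)

      edgesAt : (Sign → Bool) → Fin n → ℕ
      edgesAt q f = ∑ᵛ λ X → 𝟙 (positiveAt X) * 𝟙 (does (adjacent? X f) ∧ q (lookup X f))

      edges : (Sign → Bool) → ℕ
      edges q = ∑ᵛ λ X → 𝟙 (positiveAt X) * neighbourCount q X

      edges≡∑edgesAt : ∀ q → edges q ≡ ∑[ f < n ] edgesAt q f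
      edges≡∑edgesAt q =
        trans (∑ᵛ-cong (λ X → *-distribˡ-sum (𝟙 (positiveAt X)) (λ f → 𝟙 (does (adjacent? X f) ∧ q (lookup X f)))))
              (sum-map-∑ (λ X f → 𝟙 (positiveAt X) * 𝟙 (does (adjacent? X f) ∧ q (lookup X f))) (allSV n))

      edgesAt-flipAt : ∀ {f} → f ≢ e → edgesAt isMinus f ≡ edgesAt isPlus f
      edgesAt-flipAt {f} f≢e =
        trans (∑ᵛ-flipAt f (λ X → 𝟙 (positiveAt X) * 𝟙 (does (adjacent? X f) ∧ isMinus (lookup X f))))
              (∑ᵛ-cong flip-edge)
        where
        flip-edge : ∀ X → 𝟙 (positiveAt (flipAt f X)) * 𝟙 (does (adjacent? (flipAt f X) f) ∧ isMinus (lookup (flipAt f X) f))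
                        ≡ 𝟙 (positiveAt X) * 𝟙 (does (adjacent? X f) ∧ isPlus (lookup X f))
        flip-edge X = cong₂ (λ a b → 𝟙 a * 𝟙 b)
          (cong isPlus (lookup-flipAt-≢ X (f≢e ∘ sym)))
          (cong₂ _∧_ (does-⇔ adjacent-flipAt⇔ (adjacent? (flipAt f X) f) (adjacent? X f))
                     (trans (cong isMinus (lookup-flipAt f X)) (isMinus-neg _)))

      edgesAt-isMinus-e : edgesAt isMinus e ≡ 0
      edgesAt-isMinus-e = sum-map-zero (λ X → 𝟙-isPlus*𝟙-∧-isMinus (lookup X e) _) (allSV n)

      edgesAt-isPlus-e : 0 < edgesAt isPlus e
      edgesAt-isPlus-e with adjacent-with-sign e {plus} (λ ())
      ... | X , adj , Xe≡+ = ≤-trans (≤-reflexive (sym edge)) (∈⇒≤sum-map _ (∈-allSV X))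
        where
        edge : 𝟙 (positiveAt X) * 𝟙 (does (adjacent? X e) ∧ isPlus (lookup X e)) ≡ 1
        edge rewrite Xe≡+ | dec-true (adjacent? X e) adj = refl

      edges-isMinus<edges-isPlus : edges isMinus < edges isPlus
      edges-isMinus<edges-isPlus = begin-strict
        edges isMinus                  ≡⟨ edges≡∑edgesAt isMinus ⟩
        ∑[ f < n ] edgesAt isMinus f   <⟨ ∑-mono-< edgesAt-≤ e (subst (_< edgesAt isPlus e) (sym edgesAt-isMinus-e) edgesAt-isPlus-e) ⟩
        ∑[ f < n ] edgesAt isPlus f    ≡⟨ edges≡∑edgesAt isPlus ⟨
        edges isPlus                   ∎
        where
        open ≤-Reasoning
        edgesAt-≤ : ∀ f → edgesAt isMinus f ≤ edgesAt isPlus f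
        edgesAt-≤ f with f ≟ e
        ... | yes refl = subst (_≤ edgesAt isPlus f) (sym edgesAt-isMinus-e) z≤n
        ... | no f≢e   = ≤-reflexive (edgesAt-flipAt f≢e)

      balance : edges isPlus + 2 * cardPlus (S ∘ negV) e ≡ edges isMinus + 2 * cardPlus S e
      balance = begin
        edges isPlus + 2 * cardPlus (S ∘ negV) e
          ≡⟨ cong (λ c → edges isPlus + 2 * c) (countB≡sum (λ X → S (negV X) ∧ positiveAt X) (allSV n)) ⟩
        edges isPlus + 2 * ∑ᵛ (λ X → 𝟙 (S (negV X) ∧ positiveAt X))
          ≡⟨ ∑ᵛ-+-* (λ X → 𝟙 (positiveAt X) * neighbourCount isPlus X) (λ X → 𝟙 (S (negV X) ∧ positiveAt X)) 2 ⟨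
        ∑ᵛ (λ X → 𝟙 (positiveAt X) * neighbourCount isPlus X + 2 * 𝟙 (S (negV X) ∧ positiveAt X))
          ≡⟨ ∑ᵛ-cong restricted ⟩
        ∑ᵛ (λ X → 𝟙 (positiveAt X) * neighbourCount isMinus X + 2 * 𝟙 (S X ∧ positiveAt X))
          ≡⟨ ∑ᵛ-+-* (λ X → 𝟙 (positiveAt X) * neighbourCount isMinus X) (λ X → 𝟙 (S X ∧ positiveAt X)) 2 ⟩
        edges isMinus + 2 * ∑ᵛ (λ X → 𝟙 (S X ∧ positiveAt X))
          ≡⟨ cong (λ c → edges isMinus + 2 * c) (countB≡sum (λ X → S X ∧ positiveAt X) (allSV n)) ⟨
        edges isMinus + 2 * cardPlus S e ∎
        where
        open ≡-Reasoning
        restricted : ∀ X → 𝟙 (positiveAt X) * neighbourCount isPlus X + 2 * 𝟙 (S (negV X) ∧ positiveAt X)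
                         ≡ 𝟙 (positiveAt X) * neighbourCount isMinus X + 2 * 𝟙 (S X ∧ positiveAt X)
        restricted X = begin
          _ ≡⟨ 𝟙-*-+ (positiveAt X) _ (S (negV X)) ⟨
          _ ≡⟨ cong (𝟙 (positiveAt X) *_) (locally-balanced X) ⟩
          _ ≡⟨ 𝟙-*-+ (positiveAt X) _ (S X) ⟩
          _ ∎

      majority : card S < 2 * cardPlus S e
      majority = begin-strict
        card S                                   ≡⟨ card≡cardPlus+cardPlus∘negV S e nonzero ⟩
        cardPlus S e + cardPlus (S ∘ negV) e     <⟨ +-monoʳ-< (cardPlus S e) fewer-negated ⟩
        cardPlus S e + cardPlus S e              ≡⟨ cong (cardPlus S e +_) (+-identityʳ _) ⟨
        2 * cardPlus S e                         ∎
        where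
        open ≤-Reasoning
        nonzero : ∀ X → X ∈ˢ S → lookup X e ≢ zer
        nonzero X X∈S = tope⇒full (proj₁ (Equivalence.to (S⇔peak X) X∈S)) e
        fewer-negated : cardPlus (S ∘ negV) e < cardPlus S e
        fewer-negated = balance⇒< {edges isPlus} {edges isMinus} balance edges-isMinus<edges-isPlus

    peaks-committee : IsCommittee L S
    peaks-committee = (λ X X∈S → proj₁ (Equivalence.to (S⇔peak X) X∈S)) , majority

  peaks-critical : (S : SVSet n) → (∀ X → X ∈ˢ S ⇔ Peak X) → IsCriticalCommittee L S
  peaks-critical S S⇔peak = (Counting.peaks-committee S S⇔peak , minimal) , critical
    where
    peak : ∀ {X} → X ∈ˢ S → Peak X
    peak {X} = Equivalence.to (S⇔peak X)
    minimal : ∀ S′ → (∀ X → X ∈ˢ S′ → X ∈ˢ S) → (∃ λ X → X ∈ˢ S × ¬ X ∈ˢ S′) → ¬ IsCommittee L S′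
    minimal S′ _ (X , X∈S , X∉S′) S′-committee = X∉S′ (committee-contains-peak S′ (peak X∈S) S′-committee)
    critical : ∀ K T → K ∈ˢ S → IsTope L T → PlusStrict T K → ¬ IsCommittee L (replace S K T)
    critical K T K∈S _ (_ , e , Ke≡+ , Te≢+) committee = contradiction
      (trans (sym (committee-contains-peak (replace S K T) (peak K∈S) committee)) (replace-removes S K≢T)) λ ()
      where
      K≢T : K ≢ T
      K≢T refl = Te≢+ Ke≡+

mainTheorem3 : (n : ℕ) (L : SV n → Set) → IsOM L → Rank2 L → Simple L →
    ((S : SVSet n) → (∀ X → (X ∈ˢ S) ⇔ InKStar L X) → IsCriticalCommittee L S)
    × (∀ X → InKStar L X ⇔ InMaxPlusTopes L X)
mainTheorem3 n L om rank2 simple =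
  (λ S S⇔K* → peaks-critical S (λ X → ⇔.trans (S⇔K* X) inKStar⇔peak)) ,
  (λ X → ⇔.trans inKStar⇔peak peak⇔maxPlus)
  where open Peaks om rank2 simple
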